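{- Let $C_{213}(x,p,q,r)=\sum_{n\geq0}x^n\sum_{\sigma\in\mathcal{Q}_n(213)}p^{\mathrm{plat}(\sigma)}q^{\mathrm{des}(\sigma)}r^{\mathrm{asc}(\sigma)}$ (a formal power series in $x$ with polynomial coefficients in $p,q,r$), and let $f=C_{213}(x,p,q,r)-1$. Then $$f=xp+x(pr+qr+pq)f+xqr(r+p+q)f^2+xq^2r^2f^3.$$
   Context: A Stirling permutation of order $n$ is a permutation $\sigma=\sigma_1\cdots\sigma_{2n}$ of the multiset $\{1,1,2,2,\ldots,n,n\}$ such that, for each $i\in[n]$, every entry between the two occurrences of $i$ is greater than $i$; $\mathcal{Q}_n$ denotes the set of these ($\mathcal{Q}_0$ consists of the empty word). For $\sigma\in\mathcal{Q}_n$: $\mathrm{des}(\sigma)=\#\{i: 1\le i\le 2n-1,\ \sigma_i>\sigma_{i+1}\}$, $\mathrm{asc}(\sigma)=\#\{i: 1\le i\le 2n-1,\ \sigma_i<\sigma_{i+1}\}$, $\mathrm{plat}(\sigma)=\#\{i: 1\le i\le 2n-1,\ \sigma_i=\sigma_{i+1}\}$. $\mathcal{Q}_n(213)$ is the set of $\sigma\in\mathcal{Q}_n$ having no subsequence $\sigma_{i_1}\sigma_{i_2}\sigma_{i_3}$ ($i_1<i_2<i_3$) with $\sigma_{i_2}<\sigma_{i_1}<\sigma_{i_3}$. -}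

module Defs where

open import Level using (Level)
open import Data.Bool using (Bool; true; false; _∧_; _∨_; not; if_then_else_)
open import Data.Nat using (ℕ; zero; suc; _∸_; _<ᵇ_; _≡ᵇ_) renaming (_+_ to _+ℕ_; _*_ to _*ℕ_)
open import Data.List using (List; []; _∷_; map; concatMap; length; takeWhileᵇ; filterᵇ; foldr)
open import Data.Bool.ListAction using (any; all)
open import Algebra.Bundles using (CommutativeSemiring)

Word : Set
Word = List ℕ

range : ℕ → ℕ → List ℕ
range a zero    = []
range a (suc k) = a ∷ range (suc a) k

[1‥_] : ℕ → List ℕ
[1‥ n ] = range 1 n

words : ℕ → ℕ → List Word
words n zero      = [] ∷ []
words n (suc len) = concatMap (λ i → map (i ∷_) (words n len)) [1‥ n ]

count : ℕ → Word → ℕ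
count i []       = 0
count i (x ∷ xs) = (if i ≡ᵇ x then 1 else 0) +ℕ count i xs

elemᵇ : ℕ → Word → Bool
elemᵇ i xs = any (λ x → i ≡ᵇ x) xs

isMultisetPerm : ℕ → Word → Bool
isMultisetPerm n w = (length w ≡ᵇ (2 *ℕ n)) ∧ all (λ i → count i w ≡ᵇ 2) [1‥ n ]

-- for every occurrence of a value x that has a later occurrence, every entry
-- strictly between it and the next occurrence of x is greater than x
betweenGreater : Word → Bool
betweenGreater []       = true
betweenGreater (x ∷ xs) =
  (if elemᵇ x xs then all (λ y → x <ᵇ y) (takeWhileᵇ (λ y → not (x ≡ᵇ y)) xs) else true)
  ∧ betweenGreater xs

isStirling : ℕ → Word → Bool
isStirling n w = isMultisetPerm n w ∧ betweenGreater w

Q : ℕ → List Word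
Q n = filterᵇ (isStirling n) (words n (2 *ℕ n))

-- is there a subsequence b a c in (b ∷ xs), i.e. a then c later in xs, with a < b < c
has13After : ℕ → Word → Bool
has13After b []       = false
has13After b (a ∷ ys) = ((a <ᵇ b) ∧ any (λ c → b <ᵇ c) ys) ∨ has13After b ys

avoids213 : Word → Bool
avoids213 []       = true
avoids213 (b ∷ xs) = not (has13After b xs) ∧ avoids213 xs

Q213 : ℕ → List Word
Q213 n = filterᵇ avoids213 (Q n)

des : Word → ℕ
des []           = 0
des (x ∷ [])     = 0
des (x ∷ y ∷ ys) = (if y <ᵇ x then 1 else 0) +ℕ des (y ∷ ys)

asc : Word → ℕ
asc []           = 0
asc (x ∷ [])     = 0
asc (x ∷ y ∷ ys) = (if x <ᵇ y then 1 else 0) +ℕ asc (y ∷ ys)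

plat : Word → ℕ
plat []           = 0
plat (x ∷ [])     = 0
plat (x ∷ y ∷ ys) = (if x ≡ᵇ y then 1 else 0) +ℕ plat (y ∷ ys)

-- Generating function, coefficientwise, with values in an arbitrary
-- commutative semiring (the universal case being ℕ[p,q,r]).
-- A formal power series in x is represented by its coefficient sequence ℕ → Carrier.

module _ {c ℓ : Level} (R : CommutativeSemiring c ℓ) where
  open CommutativeSemiring R

  Series : Set c
  Series = ℕ → Carrier

  pow : Carrier → ℕ → Carrier
  pow a zero    = 1#
  pow a (suc k) = a * pow a k

  sumList : List Carrier → Carrier
  sumList = foldr _+_ 0#

  weight : Carrier → Carrier → Carrier → Word → Carrier
  weight p q r σ = pow p (plat σ) * pow q (des σ) * pow r (asc σ)

  C213 : Carrier → Carrier → Carrier → Series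
  C213 p q r n = sumList (map (weight p q r) (Q213 n))

  infixl 6 _⊕_
  _⊕_ : Series → Series → Series
  (a ⊕ b) n = a n + b n

  _·_ : Carrier → Series → Series
  (k · a) n = k * a n

  _⊛_ : Series → Series → Series
  (a ⊛ b) n = sumList (map (λ i → a i * b (n ∸ i)) (range 0 (suc n)))

  X· : Series → Series
  X· a zero    = 0#
  X· a (suc n) = a n

  one : Series
  one zero    = 1#
  one (suc n) = 0#

  -- f = C₂₁₃ - 1 (coefficientwise: constant term 0, otherwise C₂₁₃)
  fSeries : Carrier → Carrier → Carrier → Series
  fSeries p q r zero    = 0#
  fSeries p q r (suc n) = C213 p q r (suc n)

  rhsSeries : Carrier → Carrier → Carrier → Series
  rhsSeries p q r =
    X· ( (p · one)
       ⊕ ((p * r + q * r + p * q) · f)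
       ⊕ ((q * r * (r + p + q)) · (f ⊛ f))
       ⊕ ((q * q * (r * r)) · (f ⊛ (f ⊛ f))) )
    where f = fSeries p q r

-- Cutting σ ∈ 𝒬ₙ₊₁(213) at its two 1s gives σ = A′ 1 B′ 1 C′. The Stirling condition and the
-- avoidance of 213 force every entry of A′ above every entry of B′ 1 C′ and every entry of B′ above
-- every entry of C′, so A′, B′, C′ are shifted copies of some A ∈ 𝒬ₐ(213), B ∈ 𝒬_b(213),
-- C ∈ 𝒬_c(213) with a + b + c = n, and every such triple arises exactly once. Shifting preserves the
-- statistics, and the steps around the two 1s contribute a descent if A is nonempty, a plateau if B
-- is empty and an ascent and a descent otherwise, and an ascent if C is nonempty. Hence
-- f = x (1 + q f)(p + q r f)(1 + r f), and expanding the product gives the identity.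

module Submission where

open import Defs hiding (_⊕_; _·_; _⊛_; one)
open import Level using (Level)
open import Data.Nat using (ℕ; zero; suc)
open import Algebra.Bundles using (CommutativeSemiring)
import Relation.Binary.Reasoning.Setoid as SetoidReasoning

module Stirling213 where

  open import Data.Bool using (Bool; true; false; _∧_; _∨_; not; if_then_else_; T?)
  open import Data.Bool.Properties
    using (T-≡; ∧-assoc; ∧-zeroʳ; ∨-assoc; ∧-conicalˡ; ∧-conicalʳ; ∨-identityʳ; ∨-conicalˡ; ∨-conicalʳ)
  open import Data.Bool.ListAction using (any; all)
  open import Data.Nat using (ℕ; zero; suc; _+_; _*_; _∸_; _<ᵇ_; _≡ᵇ_; _≤_; _<_; z≤n; s≤s; z<s; _≟_; _<?_; ⌊_/2⌋)
  open import Data.Nat.Properties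
  open import Algebra.Properties.CommutativeSemigroup +-commutativeSemigroup
    using () renaming (interchange to +-interchange)
  open import Data.List using (List; []; _∷_; map; concatMap; cartesianProduct; length; takeWhileᵇ; _++_; head)
  open import Data.List.Properties using (∷-injective; ++-assoc; map-injective)
  open import Data.List.Extrema.Nat using (max; max<v⁺; xs≤max; ⊥≤max)
  open import Data.List.Membership.Propositional using (_∈_; _∉_; find; lose)
  open import Data.List.Membership.Propositional.Properties
    using ( ∈-map⁺; ∈-map⁻; ∈-concatMap⁺; ∈-concatMap⁻; ∈-filter⁺; ∈-filter⁻; ∈-++⁺ˡ; ∈-++⁺ʳ
          ; ∈-cartesianProduct⁺; ∈-cartesianProduct⁻)
  open import Data.List.Membership.Propositional.Properties.WithK using (unique∧set⇒bag)
  open import Data.List.Relation.Unary.Any using (here; there)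
  open import Data.List.Relation.Unary.All using (All; []; _∷_; tabulate; lookup)
  import Data.List.Relation.Unary.All as All
  import Data.List.Relation.Unary.All.Properties as All
  open import Data.List.Relation.Unary.AllPairs using ([]; _∷_)
  open import Data.List.Relation.Unary.Unique.Propositional using (Unique)
  import Data.List.Relation.Unary.Unique.Propositional.Properties as Unique
  open import Data.List.Relation.Binary.Permutation.Propositional using (_↭_)
  open import Data.List.Relation.Binary.BagAndSetEquality using (∼bag⇒↭)
  open import Data.Maybe using (fromMaybe)
  open import Data.Product using (∃; ∃₂; _×_; _,_; proj₁; proj₂)
  open import Data.Sum using (_⊎_; inj₁; inj₂)
  open import Data.Empty using (⊥; ⊥-elim)
  open import Function using (_∘_; Equivalence)
  open import Function.Bundles using (mk⇔)
  open import Relation.Nullary using (yes; no)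
  open import Relation.Binary.PropositionalEquality

  ≡ᵇ-refl : ∀ x → (x ≡ᵇ x) ≡ true
  ≡ᵇ-refl zero    = refl
  ≡ᵇ-refl (suc x) = ≡ᵇ-refl x

  ≡ᵇ-true⇒≡ : ∀ x y → (x ≡ᵇ y) ≡ true → x ≡ y
  ≡ᵇ-true⇒≡ zero    zero    _ = refl
  ≡ᵇ-true⇒≡ (suc x) (suc y) e = cong suc (≡ᵇ-true⇒≡ x y e)

  ≢⇒≡ᵇ-false : ∀ x y → x ≢ y → (x ≡ᵇ y) ≡ false
  ≢⇒≡ᵇ-false zero    zero    x≢y = ⊥-elim (x≢y refl)
  ≢⇒≡ᵇ-false zero    (suc y) _   = refl
  ≢⇒≡ᵇ-false (suc x) zero    _   = refl
  ≢⇒≡ᵇ-false (suc x) (suc y) x≢y = ≢⇒≡ᵇ-false x y (x≢y ∘ cong suc)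

  <⇒<ᵇ-true : ∀ x y → x < y → (x <ᵇ y) ≡ true
  <⇒<ᵇ-true x y x<y = Equivalence.to T-≡ (<⇒<ᵇ x<y)

  <ᵇ-true⇒< : ∀ x y → (x <ᵇ y) ≡ true → x < y
  <ᵇ-true⇒< x y e = <ᵇ⇒< x y (Equivalence.from T-≡ e)

  ≥⇒<ᵇ-false : ∀ x y → y ≤ x → (x <ᵇ y) ≡ false
  ≥⇒<ᵇ-false x       zero    _         = refl
  ≥⇒<ᵇ-false (suc x) (suc y) (s≤s y≤x) = ≥⇒<ᵇ-false x y y≤x

  <ᵇ-false⇒≥ : ∀ x y → (x <ᵇ y) ≡ false → y ≤ x
  <ᵇ-false⇒≥ x       zero    _ = z≤n
  <ᵇ-false⇒≥ (suc x) (suc y) e = s≤s (<ᵇ-false⇒≥ x y e)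

  +-≡ᵇ : ∀ k x y → (k + x ≡ᵇ k + y) ≡ (x ≡ᵇ y)
  +-≡ᵇ zero    x y = refl
  +-≡ᵇ (suc k) x y = +-≡ᵇ k x y

  +-<ᵇ : ∀ k x y → (k + x <ᵇ k + y) ≡ (x <ᵇ y)
  +-<ᵇ zero    x y = refl
  +-<ᵇ (suc k) x y = +-<ᵇ k x y

  InRange : ℕ → ℕ → ℕ → Set
  InRange lo hi x = lo ≤ x × x < hi

  ∈-range⁻ : ∀ {x} a k → x ∈ range a k → InRange a (a + k) x
  ∈-range⁻ a (suc k) (here refl) = ≤-refl , m<m+n a z<s
  ∈-range⁻ {x} a (suc k) (there x∈) with ∈-range⁻ (suc a) k x∈
  ... | a<x , x<1+a+k = <⇒≤ a<x , subst (x <_) (sym (+-suc a k)) x<1+a+k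

  ∈-range⁺ : ∀ {x} a k → InRange a (a + k) x → x ∈ range a k
  ∈-range⁺ a zero    (a≤x , x<a+0) = ⊥-elim (<-irrefl refl (≤-trans x<a+0 (subst (_≤ _) (sym (+-identityʳ a)) a≤x)))
  ∈-range⁺ {x} a (suc k) (a≤x , x<a+1+k) with a ≟ x
  ... | yes refl = here refl
  ... | no  a≢x  = there (∈-range⁺ (suc a) k (≤∧≢⇒< a≤x a≢x , subst (x <_) (+-suc a k) x<a+1+k))

  range-suc : ∀ a k → range a (suc k) ≡ range a k ++ (a + k) ∷ []
  range-suc a zero    = cong (_∷ []) (sym (+-identityʳ a))
  range-suc a (suc k) = cong (a ∷_) (trans (range-suc (suc a) k) (cong (λ x → range (suc a) k ++ x ∷ []) (sym (+-suc a k))))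

  range-unique : ∀ a k → Unique (range a k)
  range-unique a zero    = []
  range-unique a (suc k) = tabulate (λ x∈ a≡x → <-irrefl a≡x (proj₁ (∈-range⁻ (suc a) k x∈))) ∷ range-unique (suc a) k

  all-range⁻ : ∀ (P : ℕ → Bool) a k → all P (range a k) ≡ true → ∀ {v} → InRange a (a + k) v → P v ≡ true
  all-range⁻ P a k allP v∈ = go (range a k) allP (∈-range⁺ a k v∈)
    where
    go : ∀ xs → all P xs ≡ true → ∀ {v} → v ∈ xs → P v ≡ true
    go (x ∷ xs) e (here refl) = ∧-conicalˡ _ _ e
    go (x ∷ xs) e (there v∈)  = go xs (∧-conicalʳ _ _ e) v∈

  all-range⁺ : ∀ (P : ℕ → Bool) a k → (∀ {v} → InRange a (a + k) v → P v ≡ true) → all P (range a k) ≡ true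
  all-range⁺ P a zero    _ = refl
  all-range⁺ P a (suc k) h =
    cong₂ _∧_ (h (∈-range⁻ a (suc k) (here refl)))
              (all-range⁺ P (suc a) k (h ∘ ∈-range⁻ a (suc k) ∘ there ∘ ∈-range⁺ (suc a) k))

  ∈-concatMap⁻′ : ∀ {A B : Set} (f : A → List B) {xs y} → y ∈ concatMap f xs → ∃ λ x → x ∈ xs × y ∈ f x
  ∈-concatMap⁻′ f = find ∘ ∈-concatMap⁻ f

  ∈-concatMap⁺′ : ∀ {A B : Set} (f : A → List B) {xs x y} → x ∈ xs → y ∈ f x → y ∈ concatMap f xs
  ∈-concatMap⁺′ f x∈ y∈ = ∈-concatMap⁺ f (lose x∈ y∈)

  Unique-concatMap : ∀ {A B : Set} {xs : List A} (f : A → List B) (key : B → A) → Unique xs →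
                     (∀ {x} → x ∈ xs → Unique (f x)) → (∀ {x y} → x ∈ xs → y ∈ f x → key y ≡ x) →
                     Unique (concatMap f xs)
  Unique-concatMap {xs = []}     f key _            _        _     = []
  Unique-concatMap {xs = x ∷ xs} f key (x∉xs ∷ xs!) unique-f key-f =
    Unique.++⁺ (unique-f (here refl)) (Unique-concatMap f key xs! (unique-f ∘ there) (key-f ∘ there)) disjoint
    where
    disjoint : ∀ {y} → y ∈ f x × y ∈ concatMap f xs → ⊥
    disjoint (y∈fx , y∈rest) with ∈-concatMap⁻′ f y∈rest
    ... | x′ , x′∈xs , y∈fx′ = lookup x∉xs x′∈xs (trans (sym (key-f (here refl) y∈fx)) (key-f (there x′∈xs) y∈fx′))

  Unique-map⁺ : ∀ {A B : Set} (f : A → B) {xs} → (∀ {x y} → x ∈ xs → y ∈ xs → f x ≡ f y → x ≡ y) →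
                Unique xs → Unique (map f xs)
  Unique-map⁺ f {[]}     _   []            = []
  Unique-map⁺ f {x ∷ xs} inj (x∉xs ∷ xs!) =
    tabulate (λ fy∈ fx≡fy → distinct fy∈ fx≡fy) ∷ Unique-map⁺ f (λ x∈ y∈ → inj (there x∈) (there y∈)) xs!
    where
    distinct : ∀ {z} → z ∈ map f xs → f x ≡ z → ⊥
    distinct z∈ fx≡z with ∈-map⁻ f z∈
    ... | y , y∈ , refl = lookup x∉xs y∈ (inj (here refl) (there y∈) fx≡z)

  count-++ : ∀ v U V → count v (U ++ V) ≡ count v U + count v V
  count-++ v []      V = refl
  count-++ v (x ∷ U) V = trans (cong (_ +_) (count-++ v U V)) (sym (+-assoc (if v ≡ᵇ x then 1 else 0) _ _))

  count-∉ : ∀ v w → v ∉ w → count v w ≡ 0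
  count-∉ v []      _   = refl
  count-∉ v (x ∷ w) v∉ with v ≡ᵇ x in v≡ᵇx
  ... | true  = ⊥-elim (v∉ (here (≡ᵇ-true⇒≡ v x v≡ᵇx)))
  ... | false = count-∉ v w (v∉ ∘ there)

  count≡0⇒∉ : ∀ v w → count v w ≡ 0 → v ∉ w
  count≡0⇒∉ v (x ∷ w) c (here refl) rewrite ≡ᵇ-refl v with c
  ... | ()
  count≡0⇒∉ v (x ∷ w) c (there v∈) with v ≡ᵇ x
  ... | false = count≡0⇒∉ v w c v∈

  count-outside : ∀ {lo hi} v w → All (InRange lo hi) w → v < lo ⊎ hi ≤ v → count v w ≡ 0
  count-outside {lo} {hi} v w inRange outside = count-∉ v w (λ v∈ → excluded (lookup inRange v∈) outside)
    where
    excluded : InRange lo hi v → v < lo ⊎ hi ≤ v → ⊥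
    excluded (lo≤v , _) (inj₁ v<lo) = <-irrefl refl (<-≤-trans v<lo lo≤v)
    excluded (_ , v<hi) (inj₂ hi≤v) = <-irrefl refl (<-≤-trans v<hi hi≤v)

  count-split : ∀ v w m → count v w ≡ suc m → ∃₂ λ X R → w ≡ X ++ v ∷ R × v ∉ X × count v R ≡ m
  count-split v (x ∷ w) m c with v ≡ᵇ x in v≡ᵇx
  ... | true  = [] , w , cong (_∷ w) (sym (≡ᵇ-true⇒≡ v x v≡ᵇx)) , (λ ()) , suc-injective c
  ... | false with count-split v w m c
  ...   | X , R , refl , v∉X , cR = x ∷ X , R , refl , v∉x∷X , cR
    where
    v∉x∷X : v ∉ x ∷ X
    v∉x∷X (here refl) with () ← trans (sym (≡ᵇ-refl v)) v≡ᵇx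
    v∉x∷X (there v∈X) = v∉X v∈X

  countSum : ℕ → ℕ → Word → ℕ
  countSum lo zero    w = 0
  countSum lo (suc m) w = count lo w + countSum (suc lo) m w

  hits : ℕ → ℕ → ℕ → ℕ
  hits lo zero    x = 0
  hits lo (suc m) x = (if lo ≡ᵇ x then 1 else 0) + hits (suc lo) m x

  countSum-∷ : ∀ lo m x w → countSum lo m (x ∷ w) ≡ hits lo m x + countSum lo m w
  countSum-∷ lo zero    x w = refl
  countSum-∷ lo (suc m) x w =
    trans (cong (_ +_) (countSum-∷ (suc lo) m x w)) (+-interchange (if lo ≡ᵇ x then 1 else 0) (count lo w) _ _)

  hits-below : ∀ lo m x → x < lo → hits lo m x ≡ 0
  hits-below lo zero    x _    = refl
  hits-below lo (suc m) x x<lo rewrite ≢⇒≡ᵇ-false lo x (λ lo≡x → <-irrefl (sym lo≡x) x<lo) =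
    hits-below (suc lo) m x (m<n⇒m<1+n x<lo)

  hits-inRange : ∀ lo m x → InRange lo (lo + m) x → hits lo m x ≡ 1
  hits-inRange lo m x x∈ with ∈-range⁺ lo m x∈
  hits-inRange lo (suc m) x x∈ | here refl rewrite ≡ᵇ-refl lo = cong suc (hits-below (suc lo) m lo (n<1+n lo))
  hits-inRange lo (suc m) x x∈ | there x∈′
    rewrite ≢⇒≡ᵇ-false lo x (λ { refl → <-irrefl refl (proj₁ (∈-range⁻ (suc lo) m x∈′)) }) =
    hits-inRange (suc lo) m x (∈-range⁻ (suc lo) m x∈′)

  length≡countSum : ∀ lo m w → All (InRange lo (lo + m)) w → length w ≡ countSum lo m w
  length≡countSum lo m []      [] = sym (countSum-[] lo m)
    where
    countSum-[] : ∀ lo m → countSum lo m [] ≡ 0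
    countSum-[] lo zero    = refl
    countSum-[] lo (suc m) = countSum-[] (suc lo) m
  length≡countSum lo m (x ∷ w) (x∈ ∷ inRange)
    rewrite countSum-∷ lo m x w | hits-inRange lo m x x∈ = cong suc (length≡countSum lo m w inRange)

  countSum-twice : ∀ lo m w → (∀ {v} → InRange lo (lo + m) v → count v w ≡ 2) → countSum lo m w ≡ 2 * m
  countSum-twice lo zero    w _ = refl
  countSum-twice lo (suc m) w twice
    rewrite twice (∈-range⁻ lo (suc m) (here refl))
          | countSum-twice (suc lo) m w (twice ∘ ∈-range⁻ lo (suc m) ∘ there ∘ ∈-range⁺ (suc lo) m)
    = cong suc (sym (+-suc m (m + 0)))

  words-∈⁻ : ∀ n len {w} → w ∈ words n len → length w ≡ len × All (InRange 1 (suc n)) w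
  words-∈⁻ n zero      (here refl) = refl , []
  words-∈⁻ n (suc len) w∈ with ∈-concatMap⁻′ (λ i → map (i ∷_) (words n len)) {xs = range 1 n} w∈
  ... | i , i∈ , w∈′ with ∈-map⁻ (i ∷_) w∈′
  ... | w′ , w′∈ , refl with words-∈⁻ n len w′∈
  ... | len-w′ , inRange = cong suc len-w′ , ∈-range⁻ 1 n i∈ ∷ inRange

  words-∈⁺ : ∀ n {w} → All (InRange 1 (suc n)) w → w ∈ words n (length w)
  words-∈⁺ n []             = here refl
  words-∈⁺ n {x ∷ w} (x∈ ∷ inRange) =
    ∈-concatMap⁺′ (λ i → map (i ∷_) (words n (length w))) (∈-range⁺ 1 n x∈) (∈-map⁺ (x ∷_) (words-∈⁺ n inRange))

  words-unique : ∀ n len → Unique (words n len)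
  words-unique n zero      = [] ∷ []
  words-unique n (suc len) =
    Unique-concatMap (λ i → map (i ∷_) (words n len)) (fromMaybe 0 ∘ head) (range-unique 1 n)
      (λ _ → Unique.map⁺ (proj₂ ∘ ∷-injective) (words-unique n len))
      (λ _ y∈ → head-of y∈)
    where
    head-of : ∀ {i y} → y ∈ map (i ∷_) (words n len) → fromMaybe 0 (head y) ≡ i
    head-of y∈ with ∈-map⁻ _ y∈
    ... | _ , _ , refl = refl

  record Q213On (lo hi : ℕ) (w : Word) : Set where
    constructor q213On
    field
      inRange : All (InRange lo hi) w
      twice   : ∀ {v} → InRange lo hi v → count v w ≡ 2
      nested  : betweenGreater w ≡ true
      avoids  : avoids213 w ≡ true

  ∈-Q213⇒∈-words : ∀ m {w} → w ∈ Q213 m → w ∈ words m (2 * m) × isStirling m w ≡ true × avoids213 w ≡ true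
  ∈-Q213⇒∈-words m {w} w∈ with ∈-filter⁻ (T? ∘ avoids213) {xs = Q m} w∈
  ... | w∈Q , avoids with ∈-filter⁻ (T? ∘ isStirling m) {xs = words m (2 * m)} w∈Q
  ... | w∈words , stirling = w∈words , Equivalence.to T-≡ stirling , Equivalence.to T-≡ avoids

  Q213-length : ∀ m {w} → w ∈ Q213 m → length w ≡ 2 * m
  Q213-length m w∈ = proj₁ (words-∈⁻ m (2 * m) (proj₁ (∈-Q213⇒∈-words m w∈)))

  ∈-Q213⁻ : ∀ m {w} → w ∈ Q213 m → Q213On 1 (suc m) w
  ∈-Q213⁻ m {w} w∈ with ∈-Q213⇒∈-words m w∈
  ... | w∈words , stirling , avoids = record
    { inRange = proj₂ (words-∈⁻ m (2 * m) w∈words)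
    ; twice   = ≡ᵇ-true⇒≡ _ 2
                ∘ all-range⁻ (λ i → count i w ≡ᵇ 2) 1 m (∧-conicalʳ (length w ≡ᵇ 2 * m) _ (∧-conicalˡ _ _ stirling))
    ; nested  = ∧-conicalʳ _ _ stirling
    ; avoids  = avoids
    }

  ∈-Q213⁺ : ∀ m {w} → Q213On 1 (suc m) w → w ∈ Q213 m
  ∈-Q213⁺ m {w} (q213On inRange twice nested avoids) =
    ∈-filter⁺ (T? ∘ avoids213) (∈-filter⁺ (T? ∘ isStirling m) w∈words (Equivalence.from T-≡ stirling))
                               (Equivalence.from T-≡ avoids)
    where
    length-w : length w ≡ 2 * m
    length-w = trans (length≡countSum 1 m w inRange) (countSum-twice 1 m w twice)
    w∈words : w ∈ words m (2 * m)
    w∈words = subst (λ len → w ∈ words m len) length-w (words-∈⁺ m inRange)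
    stirling : isStirling m w ≡ true
    stirling rewrite length-w | ≡ᵇ-refl (2 * m) =
      cong₂ _∧_ (all-range⁺ (λ i → count i w ≡ᵇ 2) 1 m (λ v∈ → cong (_≡ᵇ 2) (twice v∈))) nested

  Q213-unique : ∀ m → Unique (Q213 m)
  Q213-unique m = Unique.filter⁺ (T? ∘ avoids213) (Unique.filter⁺ (T? ∘ isStirling m) (words-unique m (2 * m)))

  shift : ℕ → Word → Word
  shift k = map (k +_)

  count-shift : ∀ k v w → count (k + v) (shift k w) ≡ count v w
  count-shift k v []      = refl
  count-shift k v (x ∷ w) rewrite +-≡ᵇ k v x | count-shift k v w = refl

  des-shift : ∀ k w → des (shift k w) ≡ des w
  des-shift k []           = refl
  des-shift k (x ∷ [])     = refl
  des-shift k (x ∷ y ∷ ys) = cong₂ _+_ (cong (λ b → if b then 1 else 0) (+-<ᵇ k y x)) (des-shift k (y ∷ ys))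

  asc-shift : ∀ k w → asc (shift k w) ≡ asc w
  asc-shift k []           = refl
  asc-shift k (x ∷ [])     = refl
  asc-shift k (x ∷ y ∷ ys) = cong₂ _+_ (cong (λ b → if b then 1 else 0) (+-<ᵇ k x y)) (asc-shift k (y ∷ ys))

  plat-shift : ∀ k w → plat (shift k w) ≡ plat w
  plat-shift k []           = refl
  plat-shift k (x ∷ [])     = refl
  plat-shift k (x ∷ y ∷ ys) = cong₂ _+_ (cong (λ b → if b then 1 else 0) (+-≡ᵇ k x y)) (plat-shift k (y ∷ ys))

  elemᵇ-shift : ∀ k x xs → elemᵇ (k + x) (shift k xs) ≡ elemᵇ x xs
  elemᵇ-shift k x []       = refl
  elemᵇ-shift k x (y ∷ ys) rewrite +-≡ᵇ k x y | elemᵇ-shift k x ys = refl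

  all-takeWhile-shift : ∀ k x xs →
    all (k + x <ᵇ_) (takeWhileᵇ (λ y → not (k + x ≡ᵇ y)) (shift k xs)) ≡ all (x <ᵇ_) (takeWhileᵇ (λ y → not (x ≡ᵇ y)) xs)
  all-takeWhile-shift k x []       = refl
  all-takeWhile-shift k x (y ∷ ys) rewrite +-≡ᵇ k x y with x ≡ᵇ y
  ... | true  = refl
  ... | false rewrite +-<ᵇ k x y | all-takeWhile-shift k x ys = refl

  betweenGreater-shift : ∀ k w → betweenGreater (shift k w) ≡ betweenGreater w
  betweenGreater-shift k []       = refl
  betweenGreater-shift k (x ∷ xs)
    rewrite elemᵇ-shift k x xs | all-takeWhile-shift k x xs | betweenGreater-shift k xs = refl

  any-shift : ∀ k b ys → any (k + b <ᵇ_) (shift k ys) ≡ any (b <ᵇ_) ys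
  any-shift k b []       = refl
  any-shift k b (y ∷ ys) rewrite +-<ᵇ k b y | any-shift k b ys = refl

  has13After-shift : ∀ k b ys → has13After (k + b) (shift k ys) ≡ has13After b ys
  has13After-shift k b []       = refl
  has13After-shift k b (a ∷ ys) rewrite +-<ᵇ k a b | any-shift k b ys | has13After-shift k b ys = refl

  avoids213-shift : ∀ k w → avoids213 (shift k w) ≡ avoids213 w
  avoids213-shift k []       = refl
  avoids213-shift k (b ∷ xs) rewrite has13After-shift k b xs | avoids213-shift k xs = refl

  shift-InRange : ∀ k {lo hi x} → InRange lo hi x → InRange (k + lo) (k + hi) (k + x)
  shift-InRange k (lo≤x , x<hi) = +-monoʳ-≤ k lo≤x , +-monoʳ-< k x<hi

  unshift-InRange : ∀ k {lo hi x} → InRange (k + lo) (k + hi) x → k + (x ∸ k) ≡ x × InRange lo hi (x ∸ k)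
  unshift-InRange k {lo} {hi} {x} (k+lo≤x , x<k+hi) =
    k+[x∸k]≡x , +-cancelˡ-≤ k _ _ (subst (k + lo ≤_) (sym k+[x∸k]≡x) k+lo≤x)
              , +-cancelˡ-< k _ _ (subst (_< k + hi) (sym k+[x∸k]≡x) x<k+hi)
    where
    k+[x∸k]≡x : k + (x ∸ k) ≡ x
    k+[x∸k]≡x = m+[n∸m]≡n (≤-trans (m≤m+n k lo) k+lo≤x)

  Q213On-shift : ∀ k {lo hi w} → Q213On lo hi w → Q213On (k + lo) (k + hi) (shift k w)
  Q213On-shift k {w = w} (q213On inRange twice nested avoids) = record
    { inRange = All.map⁺ (All.map (shift-InRange k) inRange)
    ; twice   = λ v∈ → let k+[v∸k]≡v , v∸k∈ = unshift-InRange k v∈ in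
                  subst (λ v → count v (shift k w) ≡ 2) k+[v∸k]≡v (trans (count-shift k _ w) (twice v∸k∈))
    ; nested  = trans (betweenGreater-shift k w) nested
    ; avoids  = trans (avoids213-shift k w) avoids
    }

  Q213On-unshift : ∀ k {lo hi W} → Q213On (k + lo) (k + hi) W → ∃ λ w → W ≡ shift k w × Q213On lo hi w
  Q213On-unshift k {lo} {hi} {W} (q213On inRange twice nested avoids) = w , sym W≡ , record
    { inRange = unshift-All W inRange
    ; twice   = λ {v} v∈ → trans (sym (count-shift k v w)) (subst (λ W → count (k + v) W ≡ 2) (sym W≡) (twice (shift-InRange k v∈)))
    ; nested  = trans (sym (betweenGreater-shift k w)) (subst (λ W → betweenGreater W ≡ true) (sym W≡) nested)
    ; avoids  = trans (sym (avoids213-shift k w)) (subst (λ W → avoids213 W ≡ true) (sym W≡) avoids)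
    }
    where
    w : Word
    w = map (_∸ k) W
    unshift-All : ∀ W → All (InRange (k + lo) (k + hi)) W → All (InRange lo hi) (map (_∸ k) W)
    unshift-All W inW = All.map⁺ (All.map (proj₂ ∘ unshift-InRange k) inW)
    shift-∸ : ∀ W → All (InRange (k + lo) (k + hi)) W → shift k (map (_∸ k) W) ≡ W
    shift-∸ []      []          = refl
    shift-∸ (x ∷ W) (x∈ ∷ inW) = cong₂ _∷_ (proj₁ (unshift-InRange k x∈)) (shift-∸ W inW)
    W≡ : shift k w ≡ W
    W≡ = shift-∸ W inRange

  -- The Stirling and 213 conditions on concatenations

  elemᵇ-∉ : ∀ x V → x ∉ V → elemᵇ x V ≡ false
  elemᵇ-∉ x []      _   = refl
  elemᵇ-∉ x (y ∷ V) x∉ with x ≡ᵇ y in x≡ᵇy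
  ... | true  = ⊥-elim (x∉ (here (≡ᵇ-true⇒≡ x y x≡ᵇy)))
  ... | false = elemᵇ-∉ x V (x∉ ∘ there)

  elemᵇ-∈ : ∀ x V → x ∈ V → elemᵇ x V ≡ true
  elemᵇ-∈ x (y ∷ V) (here refl) rewrite ≡ᵇ-refl x = refl
  elemᵇ-∈ x (y ∷ V) (there x∈)  rewrite elemᵇ-∈ x V x∈ with x ≡ᵇ y
  ... | true  = refl
  ... | false = refl

  elemᵇ-true⇒∈ : ∀ x V → elemᵇ x V ≡ true → x ∈ V
  elemᵇ-true⇒∈ x (y ∷ V) e with x ≡ᵇ y in x≡ᵇy
  ... | true  = here (≡ᵇ-true⇒≡ x y x≡ᵇy)
  ... | false = there (elemᵇ-true⇒∈ x V e)

  -- The clause of betweenGreater for the occurrence of x at the head of x ∷ xs.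
  closesAbove : ℕ → Word → Bool
  closesAbove x xs = if elemᵇ x xs then all (x <ᵇ_) (takeWhileᵇ (λ y → not (x ≡ᵇ y)) xs) else true

  Above : Word → Word → Set
  Above U V = ∀ {x y} → x ∈ U → y ∈ V → y < x

  elemᵇ-++ : ∀ x U V → x ∉ V → elemᵇ x (U ++ V) ≡ elemᵇ x U
  elemᵇ-++ x []      V x∉V = elemᵇ-∉ x V x∉V
  elemᵇ-++ x (y ∷ U) V x∉V = cong ((x ≡ᵇ y) ∨_) (elemᵇ-++ x U V x∉V)

  takeWhile-++ : ∀ x U V → elemᵇ x U ≡ true →
                 takeWhileᵇ (λ y → not (x ≡ᵇ y)) (U ++ V) ≡ takeWhileᵇ (λ y → not (x ≡ᵇ y)) U
  takeWhile-++ x (y ∷ U) V x∈ᵇU with x ≡ᵇ y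
  ... | true  = refl
  ... | false = cong (y ∷_) (takeWhile-++ x U V x∈ᵇU)

  closesAbove-++ : ∀ x U V → x ∉ V → closesAbove x (U ++ V) ≡ closesAbove x U
  closesAbove-++ x U V x∉V rewrite elemᵇ-++ x U V x∉V with elemᵇ x U in x∈ᵇU
  ... | true  rewrite takeWhile-++ x U V x∈ᵇU = refl
  ... | false = refl

  betweenGreater-++ : ∀ U V → (∀ {x} → x ∈ U → x ∉ V) →
                      betweenGreater (U ++ V) ≡ betweenGreater U ∧ betweenGreater V
  betweenGreater-++ []      V disjoint = refl
  betweenGreater-++ (x ∷ U) V disjoint
    rewrite closesAbove-++ x U V (disjoint (here refl)) | betweenGreater-++ U V (disjoint ∘ there)
    = sym (∧-assoc (closesAbove x U) _ _)

  betweenGreater-∷-∉ : ∀ x V → x ∉ V → betweenGreater (x ∷ V) ≡ betweenGreater V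
  betweenGreater-∷-∉ x V x∉V rewrite elemᵇ-∉ x V x∉V = refl

  takeWhile-up-to : ∀ x U R → x ∉ U → takeWhileᵇ (λ y → not (x ≡ᵇ y)) (U ++ x ∷ R) ≡ U
  takeWhile-up-to x []      R _   rewrite ≡ᵇ-refl x = refl
  takeWhile-up-to x (y ∷ U) R x∉ with x ≡ᵇ y in x≡ᵇy
  ... | true  = ⊥-elim (x∉ (here (≡ᵇ-true⇒≡ x y x≡ᵇy)))
  ... | false = cong (y ∷_) (takeWhile-up-to x U R (x∉ ∘ there))

  all-above : ∀ m U → All (m <_) U → all (m <ᵇ_) U ≡ true
  all-above m []      []             = refl
  all-above m (y ∷ U) (m<y ∷ m<U) rewrite <⇒<ᵇ-true m y m<y = all-above m U m<U

  betweenGreater-enclosing : ∀ m U R → All (m <_) U →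
                             betweenGreater (m ∷ U ++ m ∷ R) ≡ betweenGreater (U ++ m ∷ R)
  betweenGreater-enclosing m U R m<U
    rewrite elemᵇ-∈ m (U ++ m ∷ R) (∈-++⁺ʳ U (here refl))
          | takeWhile-up-to m U R (λ m∈U → <-irrefl refl (lookup m<U m∈U))
          | all-above m U m<U
    = refl

  closesAbove-∈ : ∀ x xs → x ∈ xs → closesAbove x xs ≡ true →
                  all (x <ᵇ_) (takeWhileᵇ (λ y → not (x ≡ᵇ y)) xs) ≡ true
  closesAbove-∈ x xs x∈ e rewrite elemᵇ-∈ x xs x∈ = e

  no-return-after-smaller : ∀ P w R {v} → betweenGreater (P ++ w ∷ R) ≡ true → v ∈ P → w < v → v ∉ R
  no-return-after-smaller (x ∷ P) w R nested (there v∈P) w<v =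
    no-return-after-smaller P w R (∧-conicalʳ _ _ nested) v∈P w<v
  no-return-after-smaller (x ∷ P) w R nested (here refl) w<x x∈R with elemᵇ x P in x∈ᵇP
  ... | true  = no-return-after-smaller P w R (∧-conicalʳ _ _ nested) (elemᵇ-true⇒∈ x P x∈ᵇP) w<x x∈R
  ... | false = <-asym w<x (<ᵇ-true⇒< x w (all-∈ (takeWhile-reaches P x∈ᵇP) enclosed))
    where
    enclosed : all (x <ᵇ_) (takeWhileᵇ (λ y → not (x ≡ᵇ y)) (P ++ w ∷ R)) ≡ true
    enclosed = closesAbove-∈ x (P ++ w ∷ R) (∈-++⁺ʳ P (there x∈R)) (∧-conicalˡ _ _ nested)
    takeWhile-reaches : ∀ Q → elemᵇ x Q ≡ false → w ∈ takeWhileᵇ (λ y → not (x ≡ᵇ y)) (Q ++ w ∷ R)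
    takeWhile-reaches []      _ rewrite ≢⇒≡ᵇ-false x w (λ x≡w → <-irrefl (sym x≡w) w<x) = here refl
    takeWhile-reaches (y ∷ Q) e with x ≡ᵇ y
    ... | true  with () ← e
    ... | false = there (takeWhile-reaches Q e)
    all-∈ : ∀ {xs} → w ∈ xs → all (x <ᵇ_) xs ≡ true → (x <ᵇ w) ≡ true
    all-∈ (here refl) e = ∧-conicalˡ _ _ e
    all-∈ (there w∈)  e = all-∈ w∈ (∧-conicalʳ _ _ e)

  any-++ : ∀ (p : ℕ → Bool) U V → any p (U ++ V) ≡ any p U ∨ any p V
  any-++ p []      V = refl
  any-++ p (x ∷ U) V rewrite any-++ p U V = sym (∨-assoc (p x) _ _)

  any-false-∈ : ∀ (p : ℕ → Bool) {xs y} → any p xs ≡ false → y ∈ xs → p y ≡ false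
  any-false-∈ p e (here refl) = ∨-conicalˡ _ _ e
  any-false-∈ p e (there y∈)  = any-false-∈ p (∨-conicalʳ _ _ e) y∈

  any-below : ∀ b V → All (_< b) V → any (b <ᵇ_) V ≡ false
  any-below b []      []             = refl
  any-below b (y ∷ V) (y<b ∷ V<b) rewrite ≥⇒<ᵇ-false b y (<⇒≤ y<b) = any-below b V V<b

  has13After-below : ∀ b V → All (_< b) V → has13After b V ≡ false
  has13After-below b []      []             = refl
  has13After-below b (a ∷ V) (_ ∷ V<b) rewrite any-below b V V<b | has13After-below b V V<b =
    trans (∨-identityʳ ((a <ᵇ b) ∧ false)) (∧-zeroʳ (a <ᵇ b))

  has13After-++ : ∀ b U V → All (_< b) V → has13After b (U ++ V) ≡ has13After b U
  has13After-++ b []      V V<b = has13After-below b V V<b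
  has13After-++ b (a ∷ U) V V<b
    rewrite any-++ (b <ᵇ_) U V | any-below b V V<b | ∨-identityʳ (any (b <ᵇ_) U) | has13After-++ b U V V<b = refl

  avoids213-++ : ∀ U V → Above U V → avoids213 (U ++ V) ≡ avoids213 U ∧ avoids213 V
  avoids213-++ []      V above = refl
  avoids213-++ (b ∷ U) V above
    rewrite has13After-++ b U V (tabulate (above (here refl))) | avoids213-++ U V (above ∘ there)
    = sym (∧-assoc (not (has13After b U)) _ _)

  has13After-min : ∀ m V → All (m ≤_) V → has13After m V ≡ false
  has13After-min m []      []             = refl
  has13After-min m (a ∷ V) (m≤a ∷ m≤V) rewrite ≥⇒<ᵇ-false a m m≤a = has13After-min m V m≤V

  avoids213-min-∷ : ∀ m V → All (m ≤_) V → avoids213 (m ∷ V) ≡ avoids213 V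
  avoids213-min-∷ m V m≤V rewrite has13After-min m V m≤V = refl

  has13After-bound : ∀ b P w R {y} → has13After b (P ++ w ∷ R) ≡ false → w < b → y ∈ R → y ≤ b
  has13After-bound b []      w R e w<b y∈R rewrite <⇒<ᵇ-true w b w<b =
    <ᵇ-false⇒≥ b _ (any-false-∈ (b <ᵇ_) (∨-conicalˡ _ _ e) y∈R)
  has13After-bound b (a ∷ P) w R e w<b y∈R = has13After-bound b P w R (∨-conicalʳ _ _ e) w<b y∈R

  avoids213-bound : ∀ P w R {x y} → avoids213 (P ++ w ∷ R) ≡ true → x ∈ P → w < x → y ∈ R → y ≤ x
  avoids213-bound (b ∷ P) w R avoids (here refl) w<b y∈R =
    has13After-bound b P w R (not-true (∧-conicalˡ _ _ avoids)) w<b y∈R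
    where
    not-true : ∀ {a} → not a ≡ true → a ≡ false
    not-true {false} _ = refl
  avoids213-bound (b ∷ P) w R avoids (there x∈P) w<x y∈R = avoids213-bound P w R (∧-conicalʳ _ _ avoids) x∈P w<x y∈R

  -- Avoiding 213 gives y ≤ x, and the Stirling condition rules out y = x.
  below-after-smaller : ∀ P w R {x y} → betweenGreater (P ++ w ∷ R) ≡ true → avoids213 (P ++ w ∷ R) ≡ true →
                        x ∈ P → w < x → y ∈ R → y < x
  below-after-smaller P w R nested avoids x∈P w<x y∈R =
    ≤∧≢⇒< (avoids213-bound P w R avoids x∈P w<x y∈R)
          (λ { refl → no-return-after-smaller P w R nested x∈P w<x y∈R })

  -- Factorisation around the two occurrences of the smallest letter

  record Layered (m : ℕ) (X Y Z : Word) : Set where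
    constructor layered
    field
      X-above : Above X (m ∷ Y ++ m ∷ Z)
      Y-above : Above Y (m ∷ Z)
      Z-above : All (m <_) Z

  Above⇒∉ : ∀ {U V x} → Above U V → x ∈ U → x ∉ V
  Above⇒∉ above x∈U x∈V = <-irrefl refl (above x∈U x∈V)

  threshold⇒Above : ∀ {U V b} → All (b ≤_) U → All (_< b) V → Above U V
  threshold⇒Above b≤U V<b x∈U y∈V = <-≤-trans (lookup V<b y∈V) (lookup b≤U x∈U)

  layered-nested : ∀ {m X Y Z} → Layered m X Y Z →
    betweenGreater (X ++ m ∷ Y ++ m ∷ Z) ≡ betweenGreater X ∧ (betweenGreater Y ∧ betweenGreater Z)
  layered-nested {m} {X} {Y} {Z} (layered X-above Y-above m<Z) = begin
    bG (X ++ m ∷ Y ++ m ∷ Z)       ≡⟨ betweenGreater-++ X _ (Above⇒∉ X-above) ⟩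
    bG X ∧ bG (m ∷ Y ++ m ∷ Z)     ≡⟨ cong (bG X ∧_) (betweenGreater-enclosing m Y Z m<Y) ⟩
    bG X ∧ bG (Y ++ m ∷ Z)         ≡⟨ cong (bG X ∧_) (betweenGreater-++ Y _ (Above⇒∉ Y-above)) ⟩
    bG X ∧ (bG Y ∧ bG (m ∷ Z))     ≡⟨ cong (λ b → bG X ∧ (bG Y ∧ b)) (betweenGreater-∷-∉ m Z m∉Z) ⟩
    bG X ∧ (bG Y ∧ bG Z)           ∎
    where
    open ≡-Reasoning
    bG : Word → Bool
    bG = betweenGreater
    m<Y : All (m <_) Y
    m<Y = tabulate (λ y∈Y → Y-above y∈Y (here refl))
    m∉Z : m ∉ Z
    m∉Z m∈Z = <-irrefl refl (lookup m<Z m∈Z)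

  layered-avoids : ∀ {m X Y Z} → Layered m X Y Z →
    avoids213 (X ++ m ∷ Y ++ m ∷ Z) ≡ avoids213 X ∧ (avoids213 Y ∧ avoids213 Z)
  layered-avoids {m} {X} {Y} {Z} (layered X-above Y-above m<Z) = begin
    av (X ++ m ∷ Y ++ m ∷ Z)       ≡⟨ avoids213-++ X _ X-above ⟩
    av X ∧ av (m ∷ Y ++ m ∷ Z)     ≡⟨ cong (av X ∧_) (avoids213-min-∷ m (Y ++ m ∷ Z) (All.++⁺ m≤Y (≤-refl ∷ m≤Z))) ⟩
    av X ∧ av (Y ++ m ∷ Z)         ≡⟨ cong (av X ∧_) (avoids213-++ Y _ Y-above) ⟩
    av X ∧ (av Y ∧ av (m ∷ Z))     ≡⟨ cong (λ b → av X ∧ (av Y ∧ b)) (avoids213-min-∷ m Z m≤Z) ⟩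
    av X ∧ (av Y ∧ av Z)           ∎
    where
    open ≡-Reasoning
    av : Word → Bool
    av = avoids213
    m≤Y : All (m ≤_) Y
    m≤Y = tabulate (λ y∈Y → <⇒≤ (Y-above y∈Y (here refl)))
    m≤Z : All (m ≤_) Z
    m≤Z = All.map <⇒≤ m<Z

  count-layers : ∀ {m} v X Y Z → v ≢ m → count v (X ++ m ∷ Y ++ m ∷ Z) ≡ count v X + (count v Y + count v Z)
  count-layers {m} v X Y Z v≢m rewrite count-++ v X (m ∷ Y ++ m ∷ Z) | count-++ v Y (m ∷ Z) | ≢⇒≡ᵇ-false v m v≢m = refl

  count-separator : ∀ m X Y Z → m ∉ X → m ∉ Y → m ∉ Z → count m (X ++ m ∷ Y ++ m ∷ Z) ≡ 2
  count-separator m X Y Z m∉X m∉Y m∉Z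
    rewrite count-++ m X (m ∷ Y ++ m ∷ Z) | count-++ m Y (m ∷ Z) | ≡ᵇ-refl m
          | count-∉ m X m∉X | count-∉ m Y m∉Y | count-∉ m Z m∉Z = refl

  ∈-left : ∀ m (X Y Z : Word) {x} → x ∈ X → x ∈ X ++ m ∷ Y ++ m ∷ Z
  ∈-left m X Y Z x∈ = ∈-++⁺ˡ x∈

  ∈-middle : ∀ m (X Y Z : Word) {x} → x ∈ Y → x ∈ X ++ m ∷ Y ++ m ∷ Z
  ∈-middle m X Y Z x∈ = ∈-++⁺ʳ X (there (∈-++⁺ˡ x∈))

  ∈-right : ∀ m (X Y Z : Word) {x} → x ∈ Z → x ∈ X ++ m ∷ Y ++ m ∷ Z
  ∈-right m X Y Z x∈ = ∈-++⁺ʳ X (there (∈-++⁺ʳ Y (there x∈)))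

  below-∉ : ∀ {lo hi v} W → All (InRange lo hi) W → v < lo → v ∉ W
  below-∉ W inRange v<lo v∈W = <-irrefl refl (<-≤-trans v<lo (proj₁ (lookup inRange v∈W)))

  glue : ∀ {m t u hi X Y Z} → m < t → t ≤ u → u ≤ hi →
         Q213On u hi X → Q213On t u Y → Q213On (suc m) t Z → Q213On m hi (X ++ m ∷ Y ++ m ∷ Z)
  glue {m} {t} {u} {hi} {X} {Y} {Z} m<t t≤u u≤hi
       (q213On X-in X-twice X-nested X-avoids) (q213On Y-in Y-twice Y-nested Y-avoids) (q213On Z-in Z-twice Z-nested Z-avoids) =
    record
    { inRange = All.++⁺ (widen (<⇒≤ m<u) ≤-refl X-in)
                        ((≤-refl , m<hi) ∷ All.++⁺ (widen (<⇒≤ m<t) u≤hi Y-in) ((≤-refl , m<hi) ∷ widen (n≤1+n m) t≤hi Z-in))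
    ; twice   = twice
    ; nested  = trans (layered-nested L) (cong₂ _∧_ X-nested (cong₂ _∧_ Y-nested Z-nested))
    ; avoids  = trans (layered-avoids L) (cong₂ _∧_ X-avoids (cong₂ _∧_ Y-avoids Z-avoids))
    }
    where
    m<u : m < u
    m<u = <-≤-trans m<t t≤u
    t≤hi : t ≤ hi
    t≤hi = ≤-trans t≤u u≤hi
    m<hi : m < hi
    m<hi = <-≤-trans m<u u≤hi
    widen : ∀ {lo′ hi′ W} → m ≤ lo′ → hi′ ≤ hi → All (InRange lo′ hi′) W → All (InRange m hi) W
    widen m≤lo′ hi′≤hi = All.map (λ (lo′≤x , x<hi′) → ≤-trans m≤lo′ lo′≤x , <-≤-trans x<hi′ hi′≤hi)
    L : Layered m X Y Z
    L = layered
      (threshold⇒Above (All.map proj₁ X-in)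
                       (m<u ∷ All.++⁺ (All.map proj₂ Y-in) (m<u ∷ All.map (λ (_ , z<t) → <-≤-trans z<t t≤u) Z-in)))
      (threshold⇒Above (All.map proj₁ Y-in) (m<t ∷ All.map proj₂ Z-in))
      (All.map proj₁ Z-in)
    twice : ∀ {v} → InRange m hi v → count v (X ++ m ∷ Y ++ m ∷ Z) ≡ 2
    twice {v} (m≤v , v<hi) with v ≟ m
    ... | yes refl = count-separator m X Y Z (below-∉ X X-in m<u) (below-∉ Y Y-in m<t) (below-∉ Z Z-in ≤-refl)
    ... | no  v≢m rewrite count-layers v X Y Z v≢m with v <? t | v <? u
    ...   | yes v<t | _
      rewrite count-outside v X X-in (inj₁ (<-≤-trans v<t t≤u)) | count-outside v Y Y-in (inj₁ v<t)
      = Z-twice (≤∧≢⇒< m≤v (v≢m ∘ sym) , v<t)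
    ...   | no  v≮t | yes v<u
      rewrite count-outside v X X-in (inj₁ v<u) | count-outside v Z Z-in (inj₂ (≮⇒≥ v≮t))
      = trans (+-identityʳ _) (Y-twice (≮⇒≥ v≮t , v<u))
    ...   | no  v≮t | no  v≮u
      rewrite count-outside v Y Y-in (inj₂ (≮⇒≥ v≮u)) | count-outside v Z Z-in (inj₂ (≤-trans t≤u (≮⇒≥ v≮u)))
      = trans (+-identityʳ _) (X-twice (≮⇒≥ v≮u , v<hi))

  split-at-separators : ∀ m W → count m W ≡ 2 →
                        ∃₂ λ X Y → ∃ λ Z → W ≡ X ++ m ∷ Y ++ m ∷ Z × m ∉ X × m ∉ Y × m ∉ Z
  split-at-separators m W twice with count-split m W 1 twice
  ... | X , R , refl , m∉X , once with count-split m R 0 once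
  ... | Y , Z , refl , m∉Y , none = X , Y , Z , refl , m∉X , m∉Y , count≡0⇒∉ m Z none

  minimum-layered : ∀ {m hi X Y Z} → Q213On m hi (X ++ m ∷ Y ++ m ∷ Z) → m ∉ X → m ∉ Y → m ∉ Z → Layered m X Y Z
  minimum-layered {m} {hi} {X} {Y} {Z} (q213On inRange _ nested avoids) m∉X m∉Y m∉Z =
    layered X-above Y-above (tabulate (above-m m∉Z (∈-right m X Y Z)))
    where
    above-m : ∀ {V x} → m ∉ V → (x ∈ V → x ∈ X ++ m ∷ Y ++ m ∷ Z) → x ∈ V → m < x
    above-m m∉V embed x∈V = ≤∧≢⇒< (proj₁ (lookup inRange (embed x∈V))) (λ { refl → m∉V x∈V })
    X-above : Above X (m ∷ Y ++ m ∷ Z)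
    X-above x∈X (here refl) = above-m m∉X (∈-left m X Y Z) x∈X
    X-above x∈X (there y∈)  = below-after-smaller X m (Y ++ m ∷ Z) nested avoids x∈X (above-m m∉X (∈-left m X Y Z) x∈X) y∈
    Y-above : Above Y (m ∷ Z)
    Y-above y∈Y (here refl) = above-m m∉Y (∈-middle m X Y Z) y∈Y
    Y-above y∈Y (there z∈Z) =
      below-after-smaller (X ++ m ∷ Y) m Z (subst (λ W → betweenGreater W ≡ true) reassoc nested)
                                           (subst (λ W → avoids213 W ≡ true) reassoc avoids)
                          (∈-++⁺ʳ X (there y∈Y)) (above-m m∉Y (∈-middle m X Y Z) y∈Y) z∈Z
      where
      reassoc : X ++ m ∷ Y ++ m ∷ Z ≡ (X ++ m ∷ Y) ++ m ∷ Z
      reassoc = sym (++-assoc X (m ∷ Y) (m ∷ Z))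

  ∧₃-conical : ∀ a b c → a ∧ (b ∧ c) ≡ true → a ≡ true × b ≡ true × c ≡ true
  ∧₃-conical true true true _ = refl , refl , refl

  record Decomposition (m hi : ℕ) (W : Word) : Set where
    constructor decomposition
    field
      t u      : ℕ
      X Y Z    : Word
      W≡       : W ≡ X ++ m ∷ Y ++ m ∷ Z
      m<t      : m < t
      t≤u      : t ≤ u
      u≤hi     : u ≤ hi
      X-q213On : Q213On u hi X
      Y-q213On : Q213On t u Y
      Z-q213On : Q213On (suc m) t Z

  layered-bounds : ∀ {m hi X Y Z} → All (InRange m hi) (X ++ m ∷ Y ++ m ∷ Z) → Layered m X Y Z →
    let t = suc (max m Z) ; u = suc (max (max m Z) Y) in
    u ≤ hi × All (InRange u hi) X × All (InRange t u) Y × All (InRange (suc m) t) Z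
  layered-bounds {m} {hi} {X} {Y} {Z} inRange (layered X-above Y-above m<Z) =
    max<v⁺ (max<v⁺ m<hi Z<hi) Y<hi , tabulate X-in , tabulate Y-in , tabulate Z-in
    where
    below-hi : ∀ {x} → x ∈ X ++ m ∷ Y ++ m ∷ Z → x < hi
    below-hi = proj₂ ∘ lookup inRange
    m<hi : m < hi
    m<hi = below-hi (∈-++⁺ʳ X (here refl))
    Y<hi : All (_< hi) Y
    Y<hi = tabulate (below-hi ∘ ∈-middle m X Y Z)
    Z<hi : All (_< hi) Z
    Z<hi = tabulate (below-hi ∘ ∈-right m X Y Z)
    X-in : ∀ {x} → x ∈ X → InRange (suc (max (max m Z) Y)) hi x
    X-in x∈X = max<v⁺ (max<v⁺ (X-above x∈X (here refl)) (tabulate (X-above x∈X ∘ there ∘ ∈-++⁺ʳ Y {m ∷ Z} ∘ there)))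
                      (tabulate (X-above x∈X ∘ there ∘ ∈-++⁺ˡ {ys = m ∷ Z}))
             , below-hi (∈-left m X Y Z x∈X)
    Y-in : ∀ {y} → y ∈ Y → InRange (suc (max m Z)) (suc (max (max m Z) Y)) y
    Y-in y∈Y = max<v⁺ (Y-above y∈Y (here refl)) (tabulate (Y-above y∈Y ∘ there)) , s≤s (lookup (xs≤max (max m Z) Y) y∈Y)
    Z-in : ∀ {z} → z ∈ Z → InRange (suc m) (suc (max m Z)) z
    Z-in z∈Z = lookup m<Z z∈Z , s≤s (lookup (xs≤max m Z) z∈Z)

  layered-decomposition : ∀ {m hi X Y Z} → Q213On m hi (X ++ m ∷ Y ++ m ∷ Z) → Layered m X Y Z →
                          Decomposition m hi (X ++ m ∷ Y ++ m ∷ Z)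
  layered-decomposition {m} {hi} {X} {Y} {Z} (q213On inRange twice nested avoids) L
    with layered-bounds inRange L
       | ∧₃-conical (betweenGreater X) _ _ (trans (sym (layered-nested L)) nested)
       | ∧₃-conical (avoids213 X) _ _ (trans (sym (layered-avoids L)) avoids)
  ... | u≤hi , X-in , Y-in , Z-in | X-nested , Y-nested , Z-nested | X-avoids , Y-avoids , Z-avoids =
    decomposition t u X Y Z refl m<t t≤u u≤hi
      (q213On X-in X-twice X-nested X-avoids) (q213On Y-in Y-twice Y-nested Y-avoids) (q213On Z-in Z-twice Z-nested Z-avoids)
    where
    t u : ℕ
    t = suc (max m Z)
    u = suc (max (max m Z) Y)
    m<t : m < t
    m<t = s≤s (⊥≤max m Z)
    t≤u : t ≤ u
    t≤u = s≤s (⊥≤max (max m Z) Y)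
    twice-at : ∀ {v} → InRange m hi v → v ≢ m → count v X + (count v Y + count v Z) ≡ 2
    twice-at v∈ v≢m = trans (sym (count-layers _ X Y Z v≢m)) (twice v∈)
    X-twice : ∀ {v} → InRange u hi v → count v X ≡ 2
    X-twice {v} (u≤v , v<hi) with m<v ← <-≤-trans m<t (≤-trans t≤u u≤v) | twice-at (<⇒≤ m<v , v<hi) (>⇒≢ m<v)
    ... | c rewrite count-outside v Y Y-in (inj₂ u≤v) | count-outside v Z Z-in (inj₂ (≤-trans t≤u u≤v)) = trans (sym (+-identityʳ _)) c
    Y-twice : ∀ {v} → InRange t u v → count v Y ≡ 2
    Y-twice {v} (t≤v , v<u) with twice-at (<⇒≤ (<-≤-trans m<t t≤v) , <-≤-trans v<u u≤hi) (>⇒≢ (<-≤-trans m<t t≤v))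
    ... | c rewrite count-outside v X X-in (inj₁ v<u) | count-outside v Z Z-in (inj₂ t≤v) = trans (sym (+-identityʳ _)) c
    Z-twice : ∀ {v} → InRange (suc m) t v → count v Z ≡ 2
    Z-twice {v} (m<v , v<t) with twice-at (<⇒≤ m<v , <-≤-trans v<t (≤-trans t≤u u≤hi)) (>⇒≢ m<v)
    ... | c rewrite count-outside v X X-in (inj₁ (<-≤-trans v<t t≤u)) | count-outside v Y Y-in (inj₁ v<t) = c

  decompose : ∀ {m hi W} → m < hi → Q213On m hi W → Decomposition m hi W
  decompose {m} {W = W} m<hi q with split-at-separators m W (Q213On.twice q (≤-refl , m<hi))
  ... | X , Y , Z , refl , m∉X , m∉Y , m∉Z = layered-decomposition q (minimum-layered q m∉X m∉Y m∉Z)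

  convolve : ∀ {A B : Set} → (ℕ → List A) → (ℕ → List B) → ℕ → List (A × B)
  convolve L M n = concatMap (λ i → cartesianProduct (L i) (M (n ∸ i))) (range 0 (suc n))

  module _ {A B : Set} (L : ℕ → List A) (M : ℕ → List B) where

    ∈-convolve⁻ : ∀ {n a b} → (a , b) ∈ convolve L M n → ∃₂ λ i j → i + j ≡ n × a ∈ L i × b ∈ M j
    ∈-convolve⁻ {n} ab∈ with ∈-concatMap⁻′ (λ i → cartesianProduct (L i) (M (n ∸ i))) {xs = range 0 (suc n)} ab∈
    ... | i , i∈ , ab∈′ =
      i , n ∸ i , m+[n∸m]≡n (≤-pred (proj₂ (∈-range⁻ 0 (suc n) i∈))) , ∈-cartesianProduct⁻ (L i) (M (n ∸ i)) ab∈′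

    ∈-convolve⁺ : ∀ {i j n a b} → i + j ≡ n → a ∈ L i → b ∈ M j → (a , b) ∈ convolve L M n
    ∈-convolve⁺ {i} {j} refl a∈ b∈ =
      ∈-concatMap⁺′ (λ k → cartesianProduct (L k) (M ((i + j) ∸ k))) (∈-range⁺ 0 (suc (i + j)) (z≤n , s≤s (m≤m+n i j)))
                    (∈-cartesianProduct⁺ a∈ (subst (λ k → _ ∈ M k) (sym (m+n∸m≡n i j)) b∈))

    convolve-unique : (size : A → ℕ) → (∀ {i a} → a ∈ L i → size a ≡ i) →
                      (∀ i → Unique (L i)) → (∀ j → Unique (M j)) → ∀ n → Unique (convolve L M n)
    convolve-unique size graded L! M! n =
      Unique-concatMap (λ i → cartesianProduct (L i) (M (n ∸ i))) (size ∘ proj₁) (range-unique 0 (suc n))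
        (λ {i} _ → Unique.cartesianProduct⁺ (L! i) (M! (n ∸ i)))
        (λ {i} _ ab∈ → graded (proj₁ (∈-cartesianProduct⁻ (L i) (M (n ∸ i)) ab∈)))

  -- The bijection between 𝒬ₙ₊₁(213) and triples

  size : Word → ℕ
  size w = ⌊ length w /2⌋

  Q213-size : ∀ m {w} → w ∈ Q213 m → size w ≡ m
  Q213-size m {w} w∈ = begin
    ⌊ length w /2⌋       ≡⟨ cong ⌊_/2⌋ (Q213-length m w∈) ⟩
    ⌊ m + (m + 0) /2⌋    ≡⟨ cong (λ k → ⌊ m + k /2⌋) (+-identityʳ m) ⟩
    ⌊ m + m /2⌋          ≡⟨ n≡⌊n+n/2⌋ m ⟨
    m                    ∎
    where open ≡-Reasoning

  Triple : Set
  Triple = Word × Word × Word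

  construct : Triple → Word
  construct (A , B , C) = shift (suc (size C + size B)) A ++ 1 ∷ shift (suc (size C)) B ++ 1 ∷ shift 1 C

  splits : ℕ → List Triple
  splits = convolve Q213 (convolve Q213 Q213)

  ∈-splits⁻ : ∀ n {A B C} → (A , B , C) ∈ splits n →
              ∃₂ λ a b → ∃ λ c → a + (b + c) ≡ n × A ∈ Q213 a × B ∈ Q213 b × C ∈ Q213 c
  ∈-splits⁻ n t∈ with ∈-convolve⁻ Q213 (convolve Q213 Q213) t∈
  ... | a , j , a+j≡n , A∈ , BC∈ with ∈-convolve⁻ Q213 Q213 {n = j} BC∈
  ... | b , c , refl , B∈ , C∈ = a , b , c , a+j≡n , A∈ , B∈ , C∈

  ∈-splits⁺ : ∀ {a b c n A B C} → a + (b + c) ≡ n → A ∈ Q213 a → B ∈ Q213 b → C ∈ Q213 c → (A , B , C) ∈ splits n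
  ∈-splits⁺ {a} {b} {c} sum≡ A∈ B∈ C∈ =
    ∈-convolve⁺ Q213 (convolve Q213 Q213) {i = a} {j = b + c} sum≡ A∈ (∈-convolve⁺ Q213 Q213 {i = b} {j = c} refl B∈ C∈)

  splits-unique : ∀ n → Unique (splits n)
  splits-unique = convolve-unique Q213 (convolve Q213 Q213) size (Q213-size _) Q213-unique
                    (convolve-unique Q213 Q213 size (Q213-size _) Q213-unique Q213-unique)

  Q213-shift : ∀ k {m w} → w ∈ Q213 m → Q213On (suc k) (suc (k + m)) (shift k w)
  Q213-shift k {m} {w} w∈ = subst₂ (λ lo hi → Q213On lo hi (shift k w)) (+-comm k 1) (+-suc k m) (Q213On-shift k (∈-Q213⁻ m w∈))

  Q213-unshift : ∀ k {m W} → Q213On (suc k) (suc (k + m)) W → ∃ λ w → W ≡ shift k w × w ∈ Q213 m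
  Q213-unshift k {m} {W} q with Q213On-unshift k (subst₂ (λ lo hi → Q213On lo hi W) (+-comm 1 k) (sym (+-suc k m)) q)
  ... | w , W≡ , q′ = w , W≡ , ∈-Q213⁺ m q′

  construct-sized : ∀ A {b c B C} → B ∈ Q213 b → C ∈ Q213 c →
                    construct (A , B , C) ≡ shift (suc (c + b)) A ++ 1 ∷ shift (suc c) B ++ 1 ∷ shift 1 C
  construct-sized A {b} {c} B∈ C∈ rewrite Q213-size b B∈ | Q213-size c C∈ = refl

  reverse-sum : ∀ a b c → c + b + a ≡ a + (b + c)
  reverse-sum a b c = trans (+-comm (c + b) a) (cong (a +_) (+-comm c b))

  construct-∈ : ∀ {a b c A B C} → A ∈ Q213 a → B ∈ Q213 b → C ∈ Q213 c → construct (A , B , C) ∈ Q213 (suc (c + b + a))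
  construct-∈ {a} {b} {c} {A} A∈ B∈ C∈ rewrite construct-sized A {b} {c} B∈ C∈ =
    ∈-Q213⁺ _ (glue (s≤s (s≤s z≤n)) (m≤m+n (2 + c) b) (m≤m+n (2 + c + b) a)
                    (Q213-shift (suc (c + b)) A∈) (Q213-shift (suc c) B∈) (Q213-shift 1 C∈))

  -- Writing the cut points as 2 + c ≤ 2 + c + b ≤ 2 + c + b + a names the sizes of C, B and A.
  construct-surjective : ∀ n {W} → W ∈ Q213 (suc n) → ∃ λ t → t ∈ splits n × W ≡ construct t
  construct-surjective n W∈ with decompose (s≤s (s≤s z≤n)) (∈-Q213⁻ (suc n) W∈)
  ... | decomposition t u X Y Z refl 1<t t≤u u≤hi qX qY qZ
    with m≤n⇒∃[o]m+o≡n 1<t | m≤n⇒∃[o]m+o≡n t≤u | m≤n⇒∃[o]m+o≡n u≤hi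
  ... | c , refl | b , refl | a , refl
    with Q213-unshift (suc (c + b)) {a} qX | Q213-unshift (suc c) {b} qY | Q213-unshift 1 {c} qZ
  ... | A , refl , A∈ | B , refl , B∈ | C , refl , C∈
    = (A , B , C) , ∈-splits⁺ {a} {b} {c} (sym (reverse-sum a b c)) A∈ B∈ C∈ , sym (construct-sized A {b} {c} B∈ C∈)

  Q213-positive : ∀ m {w} → w ∈ Q213 m → All (1 ≤_) w
  Q213-positive m = All.map proj₁ ∘ Q213On.inRange ∘ ∈-Q213⁻ m

  shift-above-1 : ∀ k {A} → All (1 ≤_) A → All (1 <_) (shift (suc k) A)
  shift-above-1 k = All.map⁺ ∘ All.map (λ {x} 1≤x → s≤s (≤-trans 1≤x (m≤n+m x k)))

  1∉shift : ∀ k {W} → All (1 ≤_) W → 1 ∉ shift (suc k) W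
  1∉shift k W⁺ 1∈ = <-irrefl refl (lookup (shift-above-1 k W⁺) 1∈)

  shift-injective : ∀ k {U U′} → shift k U ≡ shift k U′ → U ≡ U′
  shift-injective k = map-injective (+-cancelˡ-≡ k _ _)

  ++-∷-cancel : ∀ {x : ℕ} U U′ {V V′} → x ∉ U → x ∉ U′ → U ++ x ∷ V ≡ U′ ++ x ∷ V′ → U ≡ U′ × V ≡ V′
  ++-∷-cancel []      []       _   _    refl = refl , refl
  ++-∷-cancel []      (y ∷ U′) _   x∉U′ refl = ⊥-elim (x∉U′ (here refl))
  ++-∷-cancel (y ∷ U) []       x∉U _    refl = ⊥-elim (x∉U (here refl))
  ++-∷-cancel (y ∷ U) (y′ ∷ U′) x∉U x∉U′ eq with ∷-injective eq
  ... | refl , eq′ with ++-∷-cancel U U′ (x∉U ∘ there) (x∉U′ ∘ there) eq′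
  ... | refl , refl = refl , refl

  construct-injective : ∀ {A B C A′ B′ C′} → All (1 ≤_) A → All (1 ≤_) B → All (1 ≤_) A′ → All (1 ≤_) B′ →
                        construct (A , B , C) ≡ construct (A′ , B′ , C′) → (A , B , C) ≡ (A′ , B′ , C′)
  construct-injective {A} {B} {C} {A′} {B′} {C′} A⁺ B⁺ A′⁺ B′⁺ eq
    with ++-∷-cancel (shift _ A) (shift _ A′) (1∉shift _ A⁺) (1∉shift _ A′⁺) eq
  ... | A≡ , BC≡ with ++-∷-cancel (shift _ B) (shift _ B′) (1∉shift _ B⁺) (1∉shift _ B′⁺) BC≡
  ... | B≡ , C≡ with shift-injective 1 C≡
  ... | refl with shift-injective _ B≡
  ... | refl with shift-injective _ A≡
  ... | refl = refl

  construct-∈-splits : ∀ n {t} → t ∈ splits n → construct t ∈ Q213 (suc n)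
  construct-∈-splits n {A , B , C} t∈ =
    let a , b , c , sum≡n , A∈ , B∈ , C∈ = ∈-splits⁻ n t∈ in
    subst (λ k → construct (A , B , C) ∈ Q213 (suc k)) (trans (reverse-sum a b c) sum≡n) (construct-∈ {a} {b} {c} A∈ B∈ C∈)

  construct-injective-on-splits : ∀ n {t t′} → t ∈ splits n → t′ ∈ splits n → construct t ≡ construct t′ → t ≡ t′
  construct-injective-on-splits n t∈ t′∈ =
    let a  , b  , _ , _ , A∈  , B∈  , _ = ∈-splits⁻ n t∈
        a′ , b′ , _ , _ , A′∈ , B′∈ , _ = ∈-splits⁻ n t′∈
    in construct-injective (Q213-positive a A∈) (Q213-positive b B∈) (Q213-positive a′ A′∈) (Q213-positive b′ B′∈)

  Q213-suc↭construct : ∀ n → Q213 (suc n) ↭ map construct (splits n)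
  Q213-suc↭construct n = ∼bag⇒↭ (unique∧set⇒bag (Q213-unique (suc n))
    (Unique-map⁺ construct (construct-injective-on-splits n) (splits-unique n)) (mk⇔ to from))
    where
    to : ∀ {W} → W ∈ Q213 (suc n) → W ∈ map construct (splits n)
    to W∈ = let t , t∈ , W≡ = construct-surjective n W∈ in subst (_∈ map construct (splits n)) (sym W≡) (∈-map⁺ construct t∈)
    from : ∀ {W} → W ∈ map construct (splits n) → W ∈ Q213 (suc n)
    from W∈ = let t , t∈ , W≡ = ∈-map⁻ construct W∈ in subst (_∈ Q213 (suc n)) (sym W≡) (construct-∈-splits n t∈)

  Stats : Set
  Stats = ℕ × ℕ × ℕ

  infixr 5 _⊞_
  _⊞_ : Stats → Stats → Stats
  (a , b , c) ⊞ (a′ , b′ , c′) = a + a′ , b + b′ , c + c′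

  stats : Word → Stats
  stats w = plat w , des w , asc w

  plateau descent ascent none : Stats
  plateau = 1 , 0 , 0
  descent = 0 , 1 , 0
  ascent  = 0 , 0 , 1
  none    = 0 , 0 , 0

  -- The steps at a separator m between blocks above it: fall U from U down to m, rise V from m up
  -- into V, and riseOrPlateau B after the first m of m B m, a plateau when B is empty.
  fall : Word → Stats
  fall []      = none
  fall (_ ∷ _) = descent

  rise : Word → Stats
  rise []      = none
  rise (_ ∷ _) = ascent

  riseOrPlateau : Word → Stats
  riseOrPlateau []      = plateau
  riseOrPlateau (_ ∷ _) = ascent

  ⊞-assoc : ∀ s t u → (s ⊞ t) ⊞ u ≡ s ⊞ (t ⊞ u)
  ⊞-assoc (a , b , c) (a′ , b′ , c′) (a″ , b″ , c″) =
    cong₂ _,_ (+-assoc a a′ a″) (cong₂ _,_ (+-assoc b b′ b″) (+-assoc c c′ c″))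

  stats-fall : ∀ m U V → All (m <_) U → stats (U ++ m ∷ V) ≡ stats U ⊞ (fall U ⊞ stats (m ∷ V))
  stats-fall m []          V []                    = refl
  stats-fall m (u ∷ [])    V (m<u ∷ [])
    rewrite ≢⇒≡ᵇ-false u m (>⇒≢ m<u) | <⇒<ᵇ-true m u m<u | ≥⇒<ᵇ-false u m (<⇒≤ m<u) = refl
  stats-fall m (u ∷ u′ ∷ U) V (m<u ∷ m<U) = begin
    step ⊞ stats ((u′ ∷ U) ++ m ∷ V)                       ≡⟨ cong (step ⊞_) (stats-fall m (u′ ∷ U) V m<U) ⟩
    step ⊞ (stats (u′ ∷ U) ⊞ (descent ⊞ stats (m ∷ V)))    ≡⟨ ⊞-assoc step _ _ ⟨
    (step ⊞ stats (u′ ∷ U)) ⊞ (descent ⊞ stats (m ∷ V))    ∎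
    where
    open ≡-Reasoning
    step : Stats
    step = (if u ≡ᵇ u′ then 1 else 0) , (if u′ <ᵇ u then 1 else 0) , (if u <ᵇ u′ then 1 else 0)

  stats-enclosing : ∀ m B C → All (m <_) B → stats (m ∷ B ++ m ∷ C) ≡ riseOrPlateau B ⊞ stats (B ++ m ∷ C)
  stats-enclosing m []      C []        rewrite ≡ᵇ-refl m | ≥⇒<ᵇ-false m m ≤-refl = refl
  stats-enclosing m (b ∷ B) C (m<b ∷ _)
    rewrite ≢⇒≡ᵇ-false m b (<⇒≢ m<b) | <⇒<ᵇ-true m b m<b | ≥⇒<ᵇ-false b m (<⇒≤ m<b) = refl

  stats-rise : ∀ m C → All (m <_) C → stats (m ∷ C) ≡ rise C ⊞ stats C
  stats-rise m []      []        = refl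
  stats-rise m (c ∷ C) (m<c ∷ _)
    rewrite ≢⇒≡ᵇ-false m c (<⇒≢ m<c) | <⇒<ᵇ-true m c m<c | ≥⇒<ᵇ-false c m (<⇒≤ m<c) = refl

  stats-layers : ∀ m X Y Z → All (m <_) X → All (m <_) Y → All (m <_) Z →
    stats (X ++ m ∷ Y ++ m ∷ Z) ≡ stats X ⊞ (fall X ⊞ (riseOrPlateau Y ⊞ (stats Y ⊞ (fall Y ⊞ (rise Z ⊞ stats Z)))))
  stats-layers m X Y Z m<X m<Y m<Z = begin
    stats (X ++ m ∷ Y ++ m ∷ Z)
      ≡⟨ stats-fall m X _ m<X ⟩
    stats X ⊞ (fall X ⊞ stats (m ∷ Y ++ m ∷ Z))
      ≡⟨ cong (λ s → stats X ⊞ (fall X ⊞ s)) (stats-enclosing m Y Z m<Y) ⟩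
    stats X ⊞ (fall X ⊞ (riseOrPlateau Y ⊞ stats (Y ++ m ∷ Z)))
      ≡⟨ cong (λ s → stats X ⊞ (fall X ⊞ (riseOrPlateau Y ⊞ s))) (stats-fall m Y Z m<Y) ⟩
    stats X ⊞ (fall X ⊞ (riseOrPlateau Y ⊞ (stats Y ⊞ (fall Y ⊞ stats (m ∷ Z)))))
      ≡⟨ cong (λ s → stats X ⊞ (fall X ⊞ (riseOrPlateau Y ⊞ (stats Y ⊞ (fall Y ⊞ s))))) (stats-rise m Z m<Z) ⟩
    stats X ⊞ (fall X ⊞ (riseOrPlateau Y ⊞ (stats Y ⊞ (fall Y ⊞ (rise Z ⊞ stats Z))))) ∎
    where open ≡-Reasoning

  stats-shift : ∀ k w → stats (shift k w) ≡ stats w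
  stats-shift k w rewrite plat-shift k w | des-shift k w | asc-shift k w = refl

  fall-shift : ∀ k w → fall (shift k w) ≡ fall w
  fall-shift k []      = refl
  fall-shift k (_ ∷ _) = refl

  rise-shift : ∀ k w → rise (shift k w) ≡ rise w
  rise-shift k []      = refl
  rise-shift k (_ ∷ _) = refl

  riseOrPlateau-shift : ∀ k w → riseOrPlateau (shift k w) ≡ riseOrPlateau w
  riseOrPlateau-shift k []      = refl
  riseOrPlateau-shift k (_ ∷ _) = refl

  stats-construct : ∀ {A B C} → All (1 ≤_) A → All (1 ≤_) B → All (1 ≤_) C →
    stats (construct (A , B , C)) ≡ stats A ⊞ (fall A ⊞ (riseOrPlateau B ⊞ (stats B ⊞ (fall B ⊞ (rise C ⊞ stats C)))))
  stats-construct {A} {B} {C} A⁺ B⁺ C⁺ =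
    trans (stats-layers 1 (shift kA A) (shift kB B) (shift 1 C) (shift-above-1 _ A⁺) (shift-above-1 _ B⁺) (shift-above-1 0 C⁺))
          (cong₂ _⊞_ (stats-shift kA A) (cong₂ _⊞_ (fall-shift kA A) (cong₂ _⊞_ (riseOrPlateau-shift kB B)
            (cong₂ _⊞_ (stats-shift kB B) (cong₂ _⊞_ (fall-shift kB B) (cong₂ _⊞_ (rise-shift 1 C) (stats-shift 1 C)))))))
    where
    kA kB : ℕ
    kA = suc (size C + size B)
    kB = suc (size C)

module Series-Algebra {c ℓ : Level} (R : CommutativeSemiring c ℓ) where

  open CommutativeSemiring R
  open Stirling213 using (∈-range⁻; range-suc; convolve)
  open import Data.Nat using (zero; suc; _∸_)
  import Data.Nat.Properties as ℕ
  open import Data.List using (List; []; _∷_; map; concatMap; cartesianProduct; _++_)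
  open import Data.List.Membership.Propositional using (_∈_)
  open import Data.List.Relation.Unary.Any using (here; there)
  open import Data.List.Relation.Binary.Permutation.Propositional using (_↭_; ↭⇒↭ₛ′)
  import Data.List.Relation.Binary.Permutation.Propositional.Properties as ↭
  open import Data.Product using (_×_; _,_; proj₁; proj₂)
  open import Function using (_∘_)
  import Relation.Binary.PropositionalEquality as ≡

  open import Relation.Binary.Reasoning.Setoid setoid
  open import Data.List.Relation.Binary.Permutation.Setoid.Properties setoid using (foldr-commMonoid)
  open import Algebra.Properties.CommutativeSemigroup +-commutativeSemigroup using (interchange)
  open import Algebra.Properties.CommutativeSemigroup *-commutativeSemigroup using (x∙yz≈y∙xz)
  open import Algebra.Solver.Ring.NaturalCoefficients.Default R using (solve; _:+_; _:*_; _:=_)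

  ∑ : ∀ {A : Set} → (A → Carrier) → List A → Carrier
  ∑ w xs = sumList R (map w xs)

  ∑-cong : ∀ {A : Set} {w w′ : A → Carrier} xs → (∀ {x} → x ∈ xs → w x ≈ w′ x) → ∑ w xs ≈ ∑ w′ xs
  ∑-cong []       _     = refl
  ∑-cong (x ∷ xs) w≈w′ = +-cong (w≈w′ (here ≡.refl)) (∑-cong xs (w≈w′ ∘ there))

  ∑-++ : ∀ {A : Set} (w : A → Carrier) xs ys → ∑ w (xs ++ ys) ≈ ∑ w xs + ∑ w ys
  ∑-++ w []       ys = sym (+-identityˡ _)
  ∑-++ w (x ∷ xs) ys = trans (+-congˡ (∑-++ w xs ys)) (sym (+-assoc _ _ _))

  ∑-concatMap : ∀ {A B : Set} (w : B → Carrier) (f : A → List B) xs → ∑ w (concatMap f xs) ≈ ∑ (λ x → ∑ w (f x)) xs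
  ∑-concatMap w f []       = refl
  ∑-concatMap w f (x ∷ xs) = trans (∑-++ w (f x) (concatMap f xs)) (+-congˡ (∑-concatMap w f xs))

  ∑-map : ∀ {A B : Set} (w : B → Carrier) (f : A → B) xs → ∑ w (map f xs) ≈ ∑ (λ x → w (f x)) xs
  ∑-map w f []       = refl
  ∑-map w f (x ∷ xs) = +-congˡ (∑-map w f xs)

  ∑-*ˡ : ∀ {A : Set} k (w : A → Carrier) xs → ∑ (λ x → k * w x) xs ≈ k * ∑ w xs
  ∑-*ˡ k w []       = sym (zeroʳ k)
  ∑-*ˡ k w (x ∷ xs) = trans (+-congˡ (∑-*ˡ k w xs)) (sym (distribˡ k _ _))

  ∑-+ : ∀ {A : Set} (w w′ : A → Carrier) xs → ∑ (λ x → w x + w′ x) xs ≈ ∑ w xs + ∑ w′ xs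
  ∑-+ w w′ []       = sym (+-identityˡ 0#)
  ∑-+ w w′ (x ∷ xs) = trans (+-congˡ (∑-+ w w′ xs)) (interchange (w x) (w′ x) _ _)

  ∑-zero : ∀ {A : Set} (w : A → Carrier) xs → (∀ {x} → x ∈ xs → w x ≈ 0#) → ∑ w xs ≈ 0#
  ∑-zero w []       _     = refl
  ∑-zero w (x ∷ xs) w≈0 = trans (+-cong (w≈0 (here ≡.refl)) (∑-zero w xs (λ x∈ → w≈0 (there x∈)))) (+-identityˡ 0#)

  ∑-↭ : ∀ {A : Set} (w : A → Carrier) {xs ys} → xs ↭ ys → ∑ w xs ≈ ∑ w ys
  ∑-↭ w xs↭ys = foldr-commMonoid +-isCommutativeMonoid (↭⇒↭ₛ′ isEquivalence (↭.map⁺ w xs↭ys))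

  ∑-cartesianProduct : ∀ {A B : Set} (g : A → Carrier) (h : B → Carrier) xs ys →
                       ∑ (λ (a , b) → g a * h b) (cartesianProduct xs ys) ≈ ∑ g xs * ∑ h ys
  ∑-cartesianProduct g h []       ys = sym (zeroˡ _)
  ∑-cartesianProduct {A} {B} g h (x ∷ xs) ys = begin
    ∑ gh (map (x ,_) ys ++ cartesianProduct xs ys)     ≈⟨ ∑-++ gh (map (x ,_) ys) _ ⟩
    ∑ gh (map (x ,_) ys) + ∑ gh (cartesianProduct xs ys) ≈⟨ +-cong (trans (∑-map gh (x ,_) ys) (∑-*ˡ (g x) h ys))
                                                                   (∑-cartesianProduct g h xs ys) ⟩
    g x * ∑ h ys + ∑ g xs * ∑ h ys                     ≈⟨ distribʳ _ _ _ ⟨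
    (g x + ∑ g xs) * ∑ h ys                            ∎
    where
    gh : A × B → Carrier
    gh (a , b) = g a * h b

  infixl 6 _⊕_
  _⊕_ : Series R → Series R → Series R
  _⊕_ = Defs._⊕_ R

  infixr 7 _·_
  _·_ : Carrier → Series R → Series R
  _·_ = Defs._·_ R

  infixr 7 _⊛_
  _⊛_ : Series R → Series R → Series R
  _⊛_ = Defs._⊛_ R

  one : Series R
  one = Defs.one R

  infix 4 _≋_
  _≋_ : Series R → Series R → Set ℓ
  a ≋ b = ∀ n → a n ≈ b n

  ⊛-cong : ∀ {a a′ b b′} → a ≋ a′ → b ≋ b′ → a ⊛ b ≋ a′ ⊛ b′
  ⊛-cong a≋a′ b≋b′ n = ∑-cong (range 0 (suc n)) (λ {i} _ → *-cong (a≋a′ i) (b≋b′ (n ∸ i)))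

  ⊛-distribʳ-⊕ : ∀ a b d → (a ⊕ b) ⊛ d ≋ a ⊛ d ⊕ b ⊛ d
  ⊛-distribʳ-⊕ a b d n =
    trans (∑-cong (range 0 (suc n)) (λ {i} _ → distribʳ (d (n ∸ i)) (a i) (b i)))
          (∑-+ (λ i → a i * d (n ∸ i)) (λ i → b i * d (n ∸ i)) (range 0 (suc n)))

  ⊛-distribˡ-⊕ : ∀ a b d → a ⊛ (b ⊕ d) ≋ a ⊛ b ⊕ a ⊛ d
  ⊛-distribˡ-⊕ a b d n =
    trans (∑-cong (range 0 (suc n)) (λ {i} _ → distribˡ (a i) (b (n ∸ i)) (d (n ∸ i))))
          (∑-+ (λ i → a i * b (n ∸ i)) (λ i → a i * d (n ∸ i)) (range 0 (suc n)))

  ·-⊛ : ∀ k a b → (k · a) ⊛ b ≋ k · (a ⊛ b)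
  ·-⊛ k a b n = trans (∑-cong (range 0 (suc n)) (λ {i} _ → *-assoc k (a i) (b (n ∸ i))))
                      (∑-*ˡ k (λ i → a i * b (n ∸ i)) (range 0 (suc n)))

  ⊛-· : ∀ k a b → a ⊛ (k · b) ≋ k · (a ⊛ b)
  ⊛-· k a b n = trans (∑-cong (range 0 (suc n)) (λ {i} _ → x∙yz≈y∙xz (a i) k (b (n ∸ i))))
                      (∑-*ˡ k (λ i → a i * b (n ∸ i)) (range 0 (suc n)))

  ⊛-identityˡ : ∀ a → one ⊛ a ≋ a
  ⊛-identityˡ a n = trans (+-cong (*-identityˡ (a n)) (∑-zero _ (range 1 n) vanish)) (+-identityʳ (a n))
    where
    vanish : ∀ {i} → i ∈ range 1 n → one i * a (n ∸ i) ≈ 0#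
    vanish {zero}  0∈ with () ← proj₁ (∈-range⁻ 1 n 0∈)
    vanish {suc i} _  = zeroˡ _

  ⊛-identityʳ : ∀ a → a ⊛ one ≋ a
  ⊛-identityʳ a n = begin
    ∑ term (range 0 (suc n))        ≡⟨ ≡.cong (∑ term) (range-suc 0 n) ⟩
    ∑ term (range 0 n ++ n ∷ [])    ≈⟨ ∑-++ term (range 0 n) (n ∷ []) ⟩
    ∑ term (range 0 n) + (term n + 0#) ≈⟨ +-cong (∑-zero term (range 0 n) vanish) (+-identityʳ _) ⟩
    0# + term n                     ≈⟨ +-identityˡ _ ⟩
    a n * one (n ∸ n)               ≡⟨ ≡.cong (λ k → a n * one k) (ℕ.n∸n≡0 n) ⟩
    a n * 1#                        ≈⟨ *-identityʳ (a n) ⟩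
    a n                             ∎
    where
    term : ℕ → Carrier
    term i = a i * one (n ∸ i)
    vanish : ∀ {i} → i ∈ range 0 n → term i ≈ 0#
    vanish {i} i∈ with n ∸ i | ℕ.m<n⇒0<n∸m (proj₂ (∈-range⁻ 0 n i∈))
    ... | suc _ | _ = zeroʳ _

  ∑-convolve : ∀ {A B : Set} (g : A → Carrier) (h : B → Carrier) (L : ℕ → List A) (M : ℕ → List B) →
               (λ n → ∑ (λ (a , b) → g a * h b) (convolve L M n)) ≋ (λ i → ∑ g (L i)) ⊛ (λ j → ∑ h (M j))
  ∑-convolve g h L M n =
    trans (∑-concatMap _ (λ i → cartesianProduct (L i) (M (n ∸ i))) (range 0 (suc n)))
          (∑-cong (range 0 (suc n)) (λ {i} _ → ∑-cartesianProduct g h (L i) (M (n ∸ i))))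

  linear-⊛ : ∀ x y a b h → (x · a ⊕ y · b) ⊛ h ≋ x · (a ⊛ h) ⊕ y · (b ⊛ h)
  linear-⊛ x y a b h n = trans (⊛-distribʳ-⊕ (x · a) (y · b) h n) (+-cong (·-⊛ x a h n) (·-⊛ y b h n))

  ⊛-linear : ∀ x y a b h → h ⊛ (x · a ⊕ y · b) ≋ x · (h ⊛ a) ⊕ y · (h ⊛ b)
  ⊛-linear x y a b h n = trans (⊛-distribˡ-⊕ h (x · a) (y · b) n) (+-cong (⊛-· x h a n) (⊛-· y h b n))

  ⊛-affine³ : ∀ α β γ δ ε ζ g n →
    ((α · one ⊕ β · g) ⊛ ((γ · one ⊕ δ · g) ⊛ (ε · one ⊕ ζ · g))) n
      ≈ α * γ * ε * one n + (α * (γ * ζ + δ * ε) + β * γ * ε) * g n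
        + (α * δ * ζ + β * (γ * ζ + δ * ε)) * (g ⊛ g) n + β * δ * ζ * (g ⊛ (g ⊛ g)) n
  ⊛-affine³ α β γ δ ε ζ g n = begin
    (A ⊛ (B ⊛ C)) n                                   ≈⟨ linear-⊛ α β one g (B ⊛ C) n ⟩
    α * (one ⊛ (B ⊛ C)) n + β * (g ⊛ (B ⊛ C)) n
                                                      ≈⟨ +-cong (*-congˡ (trans (⊛-identityˡ (B ⊛ C) n) (BC n))) (*-congˡ gBC) ⟩
    α * (γ * (ε * one n + ζ * g n) + δ * (ε * g n + ζ * gg n))
      + β * (γ * (ε * g n + ζ * gg n) + δ * (ε * gg n + ζ * ggg n))
                                                      ≈⟨ expand α β γ δ ε ζ (one n) (g n) (gg n) (ggg n) ⟩
    α * γ * ε * one n + (α * (γ * ζ + δ * ε) + β * γ * ε) * g n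
      + (α * δ * ζ + β * (γ * ζ + δ * ε)) * gg n + β * δ * ζ * ggg n ∎
    where
    A B C gg ggg : Series R
    A = α · one ⊕ β · g
    B = γ · one ⊕ δ · g
    C = ε · one ⊕ ζ · g
    gg = g ⊛ g
    ggg = g ⊛ gg
    gC : g ⊛ C ≋ ε · g ⊕ ζ · gg
    gC m = trans (⊛-linear ε ζ one g g m) (+-congʳ (*-congˡ (⊛-identityʳ g m)))
    B⊛C : B ⊛ C ≋ γ · C ⊕ δ · (g ⊛ C)
    B⊛C m = trans (linear-⊛ γ δ one g C m) (+-congʳ (*-congˡ (⊛-identityˡ C m)))
    BC : ∀ m → (B ⊛ C) m ≈ γ * (ε * one m + ζ * g m) + δ * (ε * g m + ζ * gg m)
    BC m = trans (B⊛C m) (+-congˡ (*-congˡ (gC m)))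
    gBC : (g ⊛ (B ⊛ C)) n ≈ γ * (ε * g n + ζ * gg n) + δ * (ε * gg n + ζ * ggg n)
    gBC = begin
      (g ⊛ (B ⊛ C)) n                         ≈⟨ ⊛-cong {g} (λ _ → refl) B⊛C n ⟩
      (g ⊛ (γ · C ⊕ δ · (g ⊛ C))) n           ≈⟨ ⊛-linear γ δ C (g ⊛ C) g n ⟩
      γ * (g ⊛ C) n + δ * (g ⊛ (g ⊛ C)) n     ≈⟨ +-cong (*-congˡ (gC n))
                                                       (*-congˡ (trans (⊛-cong {g} (λ _ → refl) gC n) (⊛-linear ε ζ g gg g n))) ⟩
      γ * (ε * g n + ζ * gg n) + δ * (ε * gg n + ζ * ggg n) ∎
    expand : ∀ α β γ δ ε ζ o g₁ g₂ g₃ →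
      α * (γ * (ε * o + ζ * g₁) + δ * (ε * g₁ + ζ * g₂)) + β * (γ * (ε * g₁ + ζ * g₂) + δ * (ε * g₂ + ζ * g₃))
        ≈ α * γ * ε * o + (α * (γ * ζ + δ * ε) + β * γ * ε) * g₁
          + (α * δ * ζ + β * (γ * ζ + δ * ε)) * g₂ + β * δ * ζ * g₃
    expand = solve 10 (λ α β γ δ ε ζ o g₁ g₂ g₃ →
      α :* (γ :* (ε :* o :+ ζ :* g₁) :+ δ :* (ε :* g₁ :+ ζ :* g₂))
        :+ β :* (γ :* (ε :* g₁ :+ ζ :* g₂) :+ δ :* (ε :* g₂ :+ ζ :* g₃))
      := α :* γ :* ε :* o :+ (α :* (γ :* ζ :+ δ :* ε) :+ β :* γ :* ε) :* g₁
         :+ (α :* δ :* ζ :+ β :* (γ :* ζ :+ δ :* ε)) :* g₂ :+ β :* δ :* ζ :* g₃) refl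

module Enumeration {c ℓ : Level} (R : CommutativeSemiring c ℓ) (p q r : CommutativeSemiring.Carrier R) where

  open CommutativeSemiring R
  open Stirling213
  open Series-Algebra R
  open import Data.Nat using (zero; suc; _≤_) renaming (_+_ to _+ℕ_)
  open import Data.List using ([]; _∷_; map)
  open import Data.List.Membership.Propositional using (_∈_)
  open import Data.List.Relation.Unary.All using (All)
  open import Data.Product using (_×_; _,_)
  import Relation.Binary.PropositionalEquality as ≡
  open import Relation.Binary.Reasoning.Setoid setoid
  open import Algebra.Solver.Ring.NaturalCoefficients.Default R using (solve; _:+_; _:*_; _:=_; con)

  f : Series R
  f = fSeries R p q r

  wt : Word → Carrier
  wt = weight R p q r

  -- wt w is W (stats w) by definition.
  W : Stats → Carrier
  W (a , b , c) = pow R p a * pow R q b * pow R r c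

  pow-+ : ∀ x m n → pow R x (m +ℕ n) ≈ pow R x m * pow R x n
  pow-+ x zero    n = sym (*-identityˡ _)
  pow-+ x (suc m) n = trans (*-congˡ (pow-+ x m n)) (sym (*-assoc _ _ _))

  W-⊞ : ∀ s t → W (s ⊞ t) ≈ W s * W t
  W-⊞ (a , b , c) (a′ , b′ , c′) =
    trans (*-cong (*-cong (pow-+ p a a′) (pow-+ q b b′)) (pow-+ r c c′))
          (interleave (pow R p a) (pow R q b) (pow R r c) (pow R p a′) (pow R q b′) (pow R r c′))
    where
    interleave : ∀ x y z x′ y′ z′ → x * x′ * (y * y′) * (z * z′) ≈ x * y * z * (x′ * y′ * z′)
    interleave = solve 6 (λ x y z x′ y′ z′ → x :* x′ :* (y :* y′) :* (z :* z′) := x :* y :* z :* (x′ :* y′ :* z′)) refl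

  weight-construct : ∀ {A B C} → All (1 ≤_) A → All (1 ≤_) B → All (1 ≤_) C →
    wt (construct (A , B , C)) ≈ (wt A * W (fall A)) * ((wt B * W (riseOrPlateau B ⊞ fall B)) * (wt C * W (rise C)))
  weight-construct {A} {B} {C} A⁺ B⁺ C⁺ = begin
    W (stats (construct (A , B , C)))
      ≡⟨ ≡.cong W (stats-construct A⁺ B⁺ C⁺) ⟩
    W (stats A ⊞ (fall A ⊞ (riseOrPlateau B ⊞ (stats B ⊞ (fall B ⊞ (rise C ⊞ stats C))))))
      ≈⟨ trans (W-⊞ (stats A) _) (*-congˡ (trans (W-⊞ (fall A) _) (*-congˡ (trans (W-⊞ (riseOrPlateau B) _)
           (*-congˡ (trans (W-⊞ (stats B) _) (*-congˡ (trans (W-⊞ (fall B) _) (*-congˡ (W-⊞ (rise C) (stats C))))))))))) ⟩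
    wt A * (W (fall A) * (W (riseOrPlateau B) * (wt B * (W (fall B) * (W (rise C) * wt C)))))
      ≈⟨ regroup (wt A) (W (fall A)) (W (riseOrPlateau B)) (wt B) (W (fall B)) (W (rise C)) (wt C) ⟩
    (wt A * W (fall A)) * ((wt B * (W (riseOrPlateau B) * W (fall B))) * (wt C * W (rise C)))
      ≈⟨ *-congˡ (*-congʳ (*-congˡ (sym (W-⊞ (riseOrPlateau B) (fall B))))) ⟩
    (wt A * W (fall A)) * ((wt B * W (riseOrPlateau B ⊞ fall B)) * (wt C * W (rise C))) ∎
    where
    regroup : ∀ a₁ a₂ b₁ b₂ b₃ c₁ c₂ →
              a₁ * (a₂ * (b₁ * (b₂ * (b₃ * (c₁ * c₂))))) ≈ (a₁ * a₂) * ((b₂ * (b₁ * b₃)) * (c₂ * c₁))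
    regroup = solve 7 (λ a₁ a₂ b₁ b₂ b₃ c₁ c₂ →
      a₁ :* (a₂ :* (b₁ :* (b₂ :* (b₃ :* (c₁ :* c₂))))) := (a₁ :* a₂) :* ((b₂ :* (b₁ :* b₃)) :* (c₂ :* c₁))) refl

  ∑-Q213-junction : ∀ (j : Word → Stats) s → (∀ {x w} → j (x ∷ w) ≡.≡ s) →
                    (λ i → ∑ (λ A → wt A * W (j A)) (Q213 i)) ≋ W (j []) · one ⊕ W s · f
  ∑-Q213-junction j s j-∷ zero = solve 2 (λ x y → con 1 :* con 1 :* con 1 :* x :+ con 0 := x :* con 1 :+ y :* con 0) refl (W (j [])) (W s)
  ∑-Q213-junction j s j-∷ (suc i) = begin
    ∑ (λ A → wt A * W (j A)) (Q213 (suc i)) ≈⟨ ∑-cong (Q213 (suc i)) junction-is-s ⟩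
    ∑ (λ A → W s * wt A) (Q213 (suc i))     ≈⟨ ∑-*ˡ (W s) wt (Q213 (suc i)) ⟩
    W s * f (suc i)                         ≈⟨ +-identityˡ _ ⟨
    0# + W s * f (suc i)                    ≈⟨ +-congʳ (zeroʳ (W (j []))) ⟨
    W (j []) * 0# + W s * f (suc i)         ∎
    where
    junction-is-s : ∀ {A} → A ∈ Q213 (suc i) → wt A * W (j A) ≈ W s * wt A
    junction-is-s {[]}    []∈ with () ← Q213-length (suc i) []∈
    junction-is-s {x ∷ w} _   rewrite j-∷ {x} {w} = *-comm (wt (x ∷ w)) (W s)

  affine-cong : ∀ {α α′ β β′} → α ≈ α′ → β ≈ β′ → α · one ⊕ β · f ≋ α′ · one ⊕ β′ · f
  affine-cong α≈α′ β≈β′ n = +-cong (*-congʳ α≈α′) (*-congʳ β≈β′)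

  GA GB GC : Series R
  GA i = ∑ (λ A → wt A * W (fall A)) (Q213 i)
  GB i = ∑ (λ B → wt B * W (riseOrPlateau B ⊞ fall B)) (Q213 i)
  GC i = ∑ (λ C → wt C * W (rise C)) (Q213 i)

  W-none : W none ≈ 1#
  W-none = solve 0 (con 1 :* con 1 :* con 1 := con 1) refl

  W-plateau : W plateau ≈ p
  W-plateau = solve 1 (λ p → p :* con 1 :* con 1 :* con 1 := p) refl p

  W-descent : W descent ≈ q
  W-descent = solve 1 (λ q → con 1 :* (q :* con 1) :* con 1 := q) refl q

  W-ascent : W ascent ≈ r
  W-ascent = solve 1 (λ r → con 1 :* con 1 :* (r :* con 1) := r) refl r

  W-peak : W (ascent ⊞ descent) ≈ q * r
  W-peak = solve 2 (λ q r → con 1 :* (q :* con 1) :* (r :* con 1) := q :* r) refl q r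

  GA≋ : GA ≋ 1# · one ⊕ q · f
  GA≋ i = trans (∑-Q213-junction fall descent ≡.refl i) (affine-cong W-none W-descent i)

  GB≋ : GB ≋ p · one ⊕ (q * r) · f
  GB≋ i = trans (∑-Q213-junction (λ B → riseOrPlateau B ⊞ fall B) (ascent ⊞ descent) ≡.refl i) (affine-cong W-plateau W-peak i)

  GC≋ : GC ≋ 1# · one ⊕ r · f
  GC≋ i = trans (∑-Q213-junction rise ascent ≡.refl i) (affine-cong W-none W-ascent i)

  weight-on-splits : ∀ n {t} → t ∈ splits n →
    wt (construct t) ≈ (λ (A , B , C) → (wt A * W (fall A)) * ((wt B * W (riseOrPlateau B ⊞ fall B)) * (wt C * W (rise C)))) t
  weight-on-splits n t∈ =
    let a , b , c , _ , A∈ , B∈ , C∈ = ∈-splits⁻ n t∈ in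
    weight-construct (Q213-positive a A∈) (Q213-positive b B∈) (Q213-positive c C∈)

  f-suc : ∀ n → f (suc n) ≈ (GA ⊛ (GB ⊛ GC)) n
  f-suc n = begin
    ∑ wt (Q213 (suc n))                     ≈⟨ ∑-↭ wt (Q213-suc↭construct n) ⟩
    ∑ wt (map construct (splits n))         ≈⟨ ∑-map wt construct (splits n) ⟩
    ∑ (λ t → wt (construct t)) (splits n)   ≈⟨ ∑-cong (splits n) (weight-on-splits n) ⟩
    ∑ (λ (A , BC) → gA A * gBC BC) (splits n) ≈⟨ ∑-convolve gA gBC Q213 (convolve Q213 Q213) n ⟩
    (GA ⊛ (λ j → ∑ gBC (convolve Q213 Q213 j))) n ≈⟨ ⊛-cong {GA} (λ _ → refl) (∑-convolve gB gC Q213 Q213) n ⟩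
    (GA ⊛ (GB ⊛ GC)) n                      ∎
    where
    gA gB gC : Word → Carrier
    gA A = wt A * W (fall A)
    gB B = wt B * W (riseOrPlateau B ⊞ fall B)
    gC C = wt C * W (rise C)
    gBC : Word × Word → Carrier
    gBC (B , C) = gB B * gC C

  product-expansion : ∀ n →
    ((1# · one ⊕ q · f) ⊛ ((p · one ⊕ (q * r) · f) ⊛ (1# · one ⊕ r · f))) n ≈ rhsSeries R p q r (suc n)
  product-expansion n =
    trans (⊛-affine³ 1# q p (q * r) 1# r f n) (coefficients p q r (one n) (f n) ((f ⊛ f) n) ((f ⊛ (f ⊛ f)) n))
    where
    coefficients : ∀ p q r o g₁ g₂ g₃ →
      1# * p * 1# * o + (1# * (p * r + q * r * 1#) + q * p * 1#) * g₁
        + (1# * (q * r) * r + q * (p * r + q * r * 1#)) * g₂ + q * (q * r) * r * g₃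
      ≈ p * o + (p * r + q * r + p * q) * g₁ + q * r * (r + p + q) * g₂ + q * q * (r * r) * g₃
    coefficients = solve 7 (λ p q r o g₁ g₂ g₃ →
      con 1 :* p :* con 1 :* o :+ (con 1 :* (p :* r :+ q :* r :* con 1) :+ q :* p :* con 1) :* g₁
        :+ (con 1 :* (q :* r) :* r :+ q :* (p :* r :+ q :* r :* con 1)) :* g₂ :+ q :* (q :* r) :* r :* g₃
      := p :* o :+ (p :* r :+ q :* r :+ p :* q) :* g₁ :+ q :* r :* (r :+ p :+ q) :* g₂ :+ q :* q :* (r :* r) :* g₃) refl

theorem2p1 : ∀ {c ℓ} (R : CommutativeSemiring c ℓ) (p q r : CommutativeSemiring.Carrier R) (n : ℕ) →
    CommutativeSemiring._≈_ R (fSeries R p q r n) (rhsSeries R p q r n)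
theorem2p1 R p q r zero    = CommutativeSemiring.refl R
theorem2p1 R p q r (suc n) = begin
  fSeries R p q r (suc n)                                                    ≈⟨ f-suc n ⟩
  (GA ⊛ (GB ⊛ GC)) n                                                         ≈⟨ ⊛-cong GA≋ (⊛-cong GB≋ GC≋) n ⟩
  ((1# · one ⊕ q · f) ⊛ ((p · one ⊕ (q * r) · f) ⊛ (1# · one ⊕ r · f))) n    ≈⟨ product-expansion n ⟩
  rhsSeries R p q r (suc n)                                                  ∎
  where
  open CommutativeSemiring R
  open Series-Algebra R
  open Enumeration R p q r
  open SetoidReasoning setoid
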